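{- Let $i\in K$, let $w\in W$ be a strong minuscule element with $\Lambda_w=\Lambda_i$, and let $w=s_{i_1}\cdots s_{i_r}$ be a reduced expression of $w$. For each $1\le p\le r-1$ set $u_p\coloneqq\#\{p+1\le a\le r\mid \langle\alpha_{i_a},\alpha_{i_p}^\vee\rangle=-1\}$. Then for each $1\le p\le r-1$: $u_p$ is an even nonnegative integer if $i_p=i$, and $u_p$ is an odd positive integer if $i_p\ne i$.
   Context: Let $\mathfrak g$ be a finite-dimensional simple Lie algebra over $\mathbb C$ of type $A_n$, $B_n$, $C_n$ or $D_n$, with index set $I=\{1,\dots,n\}$, simple roots $\alpha_i$, simple coroots $\alpha_i^\vee$, fundamental weights $\Lambda_i$, integral weights $P=\bigoplus_i\mathbb Z\Lambda_i$, dominant integral weights $P^+=\sum_i\mathbb Z_{\ge0}\Lambda_i$, Weyl group $W$ generated by simple reflections $s_i$. Labeling of Dynkin diagrams: type $A_n$: chain $1-2-\cdots-n$ with single bonds. Type $B_n$: chain $1,\dots,n$ with a double bond between $1$ and $2$, $\alpha_1$ short and $\alpha_2,\dots,\alpha_n$ long. Type $C_n$: same chain, double bond between $1$ and $2$, $\alpha_1$ long and $\alpha_2,\dots,\alpha_n$ short. Type $D_n$: chain $n-(n-1)-\cdots-3$ with single bonds, and node $3$ joined by single bonds to nodes $1$ and $2$. $K=I$ in types $A_n,D_n$; $K=\{1\}$ in type $B_n$; $K=I\setminus\{1\}$ in type $C_n$. For $\Lambda\in P$, $w\in W$ is $\Lambda$-minuscule if there is a reduced expression $w=s_{i_1}\cdots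 s_{i_r}$ with $\langle s_{i_{p+1}}\cdots s_{i_r}(\Lambda),\alpha_{i_p}^\vee\rangle=1$ for all $1\le p\le r$ (then it holds for every reduced expression). $w$ is dominant minuscule if it is $\Lambda$-minuscule for some $\Lambda\in P^+$; a dominant minuscule $w$ is strong minuscule if there is a unique $\Lambda\in P^+$, denoted $\Lambda_w$, such that $w$ is $\Lambda$-minuscule. -}

module Defs where

open import Data.Nat using (ℕ; zero; suc; _≤_; _<_; _≡ᵇ_; _%_)
open import Data.Bool using (Bool; true; false; if_then_else_; _∨_; _∧_)
open import Data.Integer as ℤ using (ℤ; +_; -_; _-_; _*_) renaming (_≤_ to _≤ℤ_)
open import Data.Fin using (Fin; toℕ)
open import Data.List using (List; []; _∷_; length; filter; lookup; drop)
open import Data.Unit using (⊤)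
open import Data.Empty using (⊥)
open import Data.Product using (_×_; Σ; ∃)
open import Relation.Binary.PropositionalEquality using (_≡_; _≢_)

data CartanType : Set where
  A B C D : CartanType

ValidRank : CartanType → ℕ → Set
ValidRank A n = 1 ≤ n
ValidRank B n = 2 ≤ n
ValidRank C n = 2 ≤ n
ValidRank D n = 4 ≤ n

chainAdj : ℕ → ℕ → Bool
chainAdj a b = (a ≡ᵇ suc b) ∨ (b ≡ᵇ suc a)

-- adjacency in type D: chain n-(n-1)-...-3, and 3 joined to 1 and 2
dAdj : ℕ → ℕ → Bool
dAdj 1 3 = true
dAdj 3 1 = true
dAdj 2 3 = true
dAdj 3 2 = true
dAdj a b = ((3 ≤ᵇ' a) ∧ (3 ≤ᵇ' b)) ∧ chainAdj a b
  where
  _≤ᵇ'_ : ℕ → ℕ → Bool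
  zero ≤ᵇ' _ = true
  suc m ≤ᵇ' zero = false
  suc m ≤ᵇ' suc k = m ≤ᵇ' k

-- cartanℕ t a b = ⟨ α_b , α_a^∨ ⟩ for 1-based labels a, b
cartanℕ : CartanType → ℕ → ℕ → ℤ
cartanℕ A a b = if a ≡ᵇ b then + 2 else (if chainAdj a b then - (+ 1) else + 0)
cartanℕ B 1 2 = - (+ 2)   -- α_1 short: ⟨α_2, α_1^∨⟩ = -2
cartanℕ B 2 1 = - (+ 1)
cartanℕ B a b = cartanℕ A a b
cartanℕ C 1 2 = - (+ 1)   -- α_1 long: ⟨α_2, α_1^∨⟩ = -1
cartanℕ C 2 1 = - (+ 2)
cartanℕ C a b = cartanℕ A a b
cartanℕ D a b = if a ≡ᵇ b then + 2 else (if dAdj a b then - (+ 1) else + 0)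

label : {n : ℕ} → Fin n → ℕ
label i = suc (toℕ i)

pair : (t : CartanType) {n : ℕ} → Fin n → Fin n → ℤ
pair t i j = cartanℕ t (label i) (label j)

-- integral weights, in coordinates λ ↦ (⟨λ, α_k^∨⟩)_k  (basis of fundamental weights)
Weight : ℕ → Set
Weight n = Fin n → ℤ

fund : {n : ℕ} → Fin n → Weight n
fund i k = if toℕ i ≡ᵇ toℕ k then + 1 else + 0

Dominant : {n : ℕ} → Weight n → Set
Dominant λ' = ∀ k → + 0 ≤ℤ λ' k

refl-s : (t : CartanType) {n : ℕ} → Fin n → Weight n → Weight n
refl-s t i λ' k = λ' k - λ' i * pair t k i

-- Weyl group elements are represented by words in the simple reflections;
-- act t [i₁,…,i_r] λ = s_{i₁} ⋯ s_{i_r} λ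
Word : ℕ → Set
Word n = List (Fin n)

act : (t : CartanType) {n : ℕ} → Word n → Weight n → Weight n
act t [] λ' = λ'
act t (i ∷ is) λ' = refl-s t i (act t is λ')

-- two words represent the same element of W (W acts faithfully on P)
SameElt : (t : CartanType) {n : ℕ} → Word n → Word n → Set
SameElt t u v = ∀ λ' k → act t u λ' k ≡ act t v λ' k

ReducedExpr : (t : CartanType) {n : ℕ} → Word n → Word n → Set
ReducedExpr t u w = SameElt t u w × (∀ v → SameElt t v w → length u ≤ length v)

MinWord : (t : CartanType) {n : ℕ} → Word n → Weight n → Set
MinWord t [] Λ = ⊤
MinWord t (i ∷ is) Λ = (act t is Λ i ≡ + 1) × MinWord t is Λ

IsMinuscule : (t : CartanType) {n : ℕ} → Weight n → Word n → Set
IsMinuscule t Λ w = Σ (Word _) λ u → ReducedExpr t u w × MinWord t u Λ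

StrongMinusculeWith : (t : CartanType) {n : ℕ} → Word n → Fin n → Set
StrongMinusculeWith t w i =
  IsMinuscule t (fund i) w ×
  (∀ Λ → Dominant Λ → IsMinuscule t Λ w → ∀ k → Λ k ≡ fund i k)

InK : CartanType → {n : ℕ} → Fin n → Set
InK A i = ⊤
InK D i = ⊤
InK B i = label i ≡ 1
InK C i = label i ≢ 1

-- u_p for the 0-based position q = p - 1 of a reduced word:
-- #{ a > p | ⟨α_{i_a}, α_{i_p}^∨⟩ = -1 }
uCount : (t : CartanType) {n : ℕ} (ws : Word n) → Fin (length ws) → ℕ
uCount t ws q = length (filter (λ y → pair t (lookup ws q) y ℤ.≟ - (+ 1)) (drop (suc (toℕ q)) ws))

-- The number in the minuscule condition at position p of a word i₁ ⋯ i_r is ⟨Λ, β_p^∨⟩ for the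
-- inversion coroot β_p^∨ = s_{i_r} ⋯ s_{i_{p+1}} α_{i_p}^∨.  The W-invariant form on the coroot
-- lattice is positive definite (an explicit sum of squares in each type); hence a W-translate of a
-- simple coroot that is nonnegative but stops being so under a simple reflection s_m is α_m^∨
-- itself.  It follows that inversion coroots of reduced words are nonnegative (otherwise two
-- letters of the word cancel), and that an inversion coroot of the reduced word ws turns negative
-- along the given Λ_i-minuscule word for w, at a letter where it is an inversion coroot of that
-- word.  So every reduced expression of w is Λ_i-minuscule.  Along a minuscule word every
-- reflection subtracts a simple root, which gives
--   1 = ⟨Λ_i, α_{i_p}^∨⟩ - Σ_{a > p} ⟨α_{i_a}, α_{i_p}^∨⟩,
-- and as every Cartan integer is -1 or even, u_p ≡ 1 - ⟨Λ_i, α_{i_p}^∨⟩ (mod 2).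

module Submission where

open import Defs
open import Data.Bool.Base using (Bool; true; false; if_then_else_; T)
import Data.Bool.Properties as Bool
open import Data.Empty using (⊥-elim)
open import Data.Fin.Base as Fin using (Fin; zero; suc; toℕ)
import Data.Fin.Properties as Fin
open import Data.Integer.Base as ℤ using (ℤ; +_; -_; _+_; _-_; _*_; -[1+_]; +≤+; +<+)
import Data.Integer.Properties as ℤ
open import Algebra.Properties.Semiring.Sum ℤ.+-*-semiring
  using (sum; sum-syntax; sum-cong-≗; ∑-distrib-+; ∑-comm; *-distribˡ-sum; sum-replicate-zero; sum-init-last)
open import Data.Integer.Tactic.RingSolver using (solve-∀)
open import Data.List.Base using (List; []; _∷_; _++_; length; lookup; reverse; filter; drop; take)
import Data.List.Properties as List
open import Data.Nat.Base as ℕ using (ℕ; zero; suc; _<_; _%_; z≤n; s≤s; _≡ᵇ_)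
import Data.Nat.Properties as ℕ
open import Data.Nat.DivMod using ([m+kn]%n≡m%n)
open import Data.Product.Base using (_×_; ∃-syntax; _,_; proj₁; proj₂)
open import Data.Sum.Base using (_⊎_; inj₁; inj₂)
open import Data.Unit.Base using (tt)
open import Function.Base using (_∘_)
open import Function.Bundles using (Equivalence)
open import Relation.Binary.PropositionalEquality
  using (_≡_; _≢_; _≗_; refl; sym; trans; cong; cong₂; subst; subst₂; module ≡-Reasoning)
open import Relation.Nullary using (¬_; yes; no)

square-nonneg : ∀ a → + 0 ℤ.≤ a * a
square-nonneg (+ m) = subst (+ 0 ℤ.≤_) (ℤ.pos-* m m) (+≤+ z≤n)
square-nonneg -[1+ m ] = +≤+ z≤n

square≤0⇒≡0 : ∀ a → a * a ℤ.≤ + 0 → a ≡ + 0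
square≤0⇒≡0 a a²≤0 with ℤ.i*j≡0⇒i≡0∨j≡0 a (ℤ.≤-antisym a²≤0 (square-nonneg a))
... | inj₁ a≡0 = a≡0
... | inj₂ a≡0 = a≡0

nonneg-+≤0 : ∀ {a b} → + 0 ℤ.≤ a → + 0 ℤ.≤ b → a + b ℤ.≤ + 0 → a ℤ.≤ + 0 × b ℤ.≤ + 0
nonneg-+≤0 {a} {b} 0≤a 0≤b a+b≤0 =
  ℤ.≤-trans (ℤ.i≤i+j a b {{ℤ.nonNegative 0≤b}}) a+b≤0 ,
  ℤ.≤-trans (ℤ.i≤j+i b a {{ℤ.nonNegative 0≤a}}) a+b≤0

a+a≡0⇒a≡0 : ∀ a → a + a ≡ + 0 → a ≡ + 0
a+a≡0⇒a≡0 a a+a≡0 with ℤ.i*j≡0⇒i≡0∨j≡0 (+ 2) (trans (double a) a+a≡0)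
  where double : ∀ a → + 2 * a ≡ a + a
        double = solve-∀
... | inj₁ ()
... | inj₂ a≡0 = a≡0

pos-*≡1⇒≡1 : ∀ {a} b → + 0 ℤ.< a → a * b ≡ + 1 → a ≡ + 1
pos-*≡1⇒≡1 {+ m} b _ ab≡1 =
  cong +_ (ℕ.m*n≡1⇒m≡1 m ℤ.∣ b ∣ (trans (sym (ℤ.abs-* (+ m) b)) (cong ℤ.∣_∣ ab≡1)))

pos-*-pos : ∀ {a b} → + 0 ℤ.< a → + 0 ℤ.< b → + 0 ℤ.< a * b
pos-*-pos (+<+ (s≤s _)) (+<+ (s≤s _)) = +<+ (s≤s z≤n)

pos-*⇒pos : ∀ {a} b → + 0 ℤ.< a → + 0 ℤ.< a * b → + 0 ℤ.< b
pos-*⇒pos {a} b 0<a 0<ab =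
  ℤ.*-cancelˡ-<-nonNeg a {{ℤ.nonNegative (ℤ.<⇒≤ 0<a)}} (subst (ℤ._< a * b) (sym (ℤ.*-zeroʳ a)) 0<ab)

1≤-*-1≤ : ∀ {a b} → + 1 ℤ.≤ a → + 1 ℤ.≤ b → + 1 ℤ.≤ a * b
1≤-*-1≤ (+≤+ (s≤s _)) (+≤+ (s≤s _)) = +≤+ (s≤s z≤n)

nonneg-*-nonpos : ∀ {a b} → + 0 ℤ.≤ a → b ℤ.≤ + 0 → a * b ℤ.≤ + 0
nonneg-*-nonpos {a} {b} 0≤a b≤0 = subst (a * b ℤ.≤_) (ℤ.*-zeroʳ a) (ℤ.*-monoˡ-≤-nonNeg a {{ℤ.nonNegative 0≤a}} b≤0)

i-j<0⇒i<j : ∀ i j → i - j ℤ.< + 0 → i ℤ.< j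
i-j<0⇒i<j i j i-j<0 = subst₂ ℤ._<_ (cancel i j) (ℤ.+-identityˡ j) (ℤ.+-monoˡ-< j i-j<0)
  where cancel : ∀ i j → i - j + j ≡ i
        cancel = solve-∀

i<j⇒1≤j-i : ∀ {i j} → i ℤ.< j → + 1 ℤ.≤ j - i
i<j⇒1≤j-i {i} {j} i<j = subst (ℤ._≤ j - i) (cancel i) (ℤ.+-monoˡ-≤ (- i) (ℤ.i<j⇒suc[i]≤j i<j))
  where cancel : ∀ i → + 1 + i - i ≡ + 1
        cancel = solve-∀

positive-below-double : ∀ {κ L} → + 0 ℤ.≤ κ → κ ℤ.< L → L ℤ.≤ + 2 * κ → + 0 ℤ.< κ
positive-below-double {+ zero}  _ κ<L L≤2κ = ⊥-elim (ℤ.<-irrefl refl (ℤ.<-≤-trans κ<L L≤2κ))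
positive-below-double {+ suc k} _ _   _    = +<+ (s≤s z≤n)

∑-mono-≤ : ∀ {n} {f g : Fin n → ℤ} → (∀ k → f k ℤ.≤ g k) → sum f ℤ.≤ sum g
∑-mono-≤ {zero}  f≤g = ℤ.≤-refl
∑-mono-≤ {suc n} f≤g = ℤ.+-mono-≤ (f≤g zero) (∑-mono-≤ (f≤g ∘ suc))

∑-linear : ∀ {n} (f : Fin n → ℤ) s g → ∑[ k < n ] (f k + s * g k) ≡ sum f + s * sum g
∑-linear f s g = trans (∑-distrib-+ f (λ k → s * g k)) (cong (λ z → sum f + z) (sym (*-distribˡ-sum s g)))

≡ᵇ-refl : ∀ a → (a ≡ᵇ a) ≡ true
≡ᵇ-refl a = Equivalence.to Bool.T-≡ (ℕ.≡⇒≡ᵇ a a refl)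

fund-diag : ∀ {n} (j : Fin n) → fund j j ≡ + 1
fund-diag j rewrite ≡ᵇ-refl (toℕ j) = refl

fund-off : ∀ {n} {j k : Fin n} → j ≢ k → fund j k ≡ + 0
fund-off {j = j} {k} j≢k with toℕ j ≡ᵇ toℕ k in eq
... | true  = ⊥-elim (j≢k (Fin.toℕ-injective (ℕ.≡ᵇ⇒≡ (toℕ j) (toℕ k) (subst T (sym eq) tt))))
... | false = refl

fund-nonneg : ∀ {n} (j k : Fin n) → + 0 ℤ.≤ fund j k
fund-nonneg j k with toℕ j ≡ᵇ toℕ k
... | true  = +≤+ z≤n
... | false = +≤+ z≤n

∑-fundʳ : ∀ {n} (f : Fin n → ℤ) j → ∑[ k < n ] (f k * fund j k) ≡ f j
∑-fundʳ {suc n} f zero = begin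
  f zero * + 1 + ∑[ k < n ] (f (suc k) * + 0)
    ≡⟨ cong₂ _+_ (ℤ.*-identityʳ (f zero)) (trans (sum-cong-≗ (ℤ.*-zeroʳ ∘ f ∘ suc)) (sum-replicate-zero n)) ⟩
  f zero + + 0 ≡⟨ ℤ.+-identityʳ (f zero) ⟩
  f zero ∎
  where open ≡-Reasoning
∑-fundʳ {suc n} f (suc j) =
  trans (cong (_+ ∑[ k < n ] (f (suc k) * fund j k)) (ℤ.*-zeroʳ (f zero)))
        (trans (ℤ.+-identityˡ _) (∑-fundʳ (f ∘ suc) j))

∑-fundˡ : ∀ {n} (f : Fin n → ℤ) j → ∑[ k < n ] (fund j k * f k) ≡ f j
∑-fundˡ f j = trans (sum-cong-≗ (λ k → ℤ.*-comm (fund j k) (f k))) (∑-fundʳ f j)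

-- The Cartan matrices, indexed from 0

EvenOrMinusOne : ℤ → Set
EvenOrMinusOne x = x ≡ - (+ 1) ⊎ ∃[ m ] x ≡ m + m

δ : ℕ → ℕ → ℤ
δ a b = if a ≡ᵇ b then + 1 else + 0

δ-sym : ∀ a b → δ a b ≡ δ b a
δ-sym zero    zero    = refl
δ-sym zero    (suc b) = refl
δ-sym (suc a) zero    = refl
δ-sym (suc a) (suc b) = δ-sym a b

cartan : CartanType → ℕ → ℕ → ℤ
cartan t a b = cartanℕ t (suc a) (suc b)

private
  simplyLaced : Bool → Bool → ℤ
  simplyLaced diag adj = if diag then + 2 else (if adj then - (+ 1) else + 0)

  simplyLaced-diag : ∀ {diag} adj → diag ≡ true → simplyLaced diag adj ≡ + 2
  simplyLaced-diag adj refl = refl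

  simplyLaced-offDiag : ∀ diag adj → simplyLaced diag adj ℤ.≤ + 2 * (if diag then + 1 else + 0)
  simplyLaced-offDiag true  adj   = ℤ.≤ᵇ⇒≤ tt
  simplyLaced-offDiag false true  = ℤ.≤ᵇ⇒≤ tt
  simplyLaced-offDiag false false = ℤ.≤ᵇ⇒≤ tt

  simplyLaced-evenOrMinusOne : ∀ diag adj → EvenOrMinusOne (simplyLaced diag adj)
  simplyLaced-evenOrMinusOne true  adj   = inj₂ (+ 1 , refl)
  simplyLaced-evenOrMinusOne false true  = inj₁ refl
  simplyLaced-evenOrMinusOne false false = inj₂ (+ 0 , refl)

cartan-diag : ∀ t a → cartan t a a ≡ + 2
cartan-diag A a = simplyLaced-diag (chainAdj (suc a) (suc a)) (≡ᵇ-refl a)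
cartan-diag D a = simplyLaced-diag (dAdj (suc a) (suc a)) (≡ᵇ-refl a)
cartan-diag B zero = refl
cartan-diag B (suc zero) = refl
cartan-diag B (suc (suc a)) = cartan-diag A (suc (suc a))
cartan-diag C zero = refl
cartan-diag C (suc zero) = refl
cartan-diag C (suc (suc a)) = cartan-diag A (suc (suc a))

cartan-offDiag : ∀ t a b → cartan t a b ℤ.≤ + 2 * δ a b
cartan-offDiag A a b = simplyLaced-offDiag (a ≡ᵇ b) (chainAdj (suc a) (suc b))
cartan-offDiag D a b = simplyLaced-offDiag (a ≡ᵇ b) (dAdj (suc a) (suc b))
cartan-offDiag B zero zero = ℤ.≤ᵇ⇒≤ tt
cartan-offDiag B zero (suc zero) = ℤ.≤ᵇ⇒≤ tt
cartan-offDiag B zero (suc (suc b)) = cartan-offDiag A zero (suc (suc b))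
cartan-offDiag B (suc zero) zero = ℤ.≤ᵇ⇒≤ tt
cartan-offDiag B (suc zero) (suc zero) = ℤ.≤ᵇ⇒≤ tt
cartan-offDiag B (suc zero) (suc (suc b)) = cartan-offDiag A (suc zero) (suc (suc b))
cartan-offDiag B (suc (suc a)) b = cartan-offDiag A (suc (suc a)) b
cartan-offDiag C zero zero = ℤ.≤ᵇ⇒≤ tt
cartan-offDiag C zero (suc zero) = ℤ.≤ᵇ⇒≤ tt
cartan-offDiag C zero (suc (suc b)) = cartan-offDiag A zero (suc (suc b))
cartan-offDiag C (suc zero) zero = ℤ.≤ᵇ⇒≤ tt
cartan-offDiag C (suc zero) (suc zero) = ℤ.≤ᵇ⇒≤ tt
cartan-offDiag C (suc zero) (suc (suc b)) = cartan-offDiag A (suc zero) (suc (suc b))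
cartan-offDiag C (suc (suc a)) b = cartan-offDiag A (suc (suc a)) b

cartan-evenOrMinusOne : ∀ t a b → EvenOrMinusOne (cartan t a b)
cartan-evenOrMinusOne A a b = simplyLaced-evenOrMinusOne (a ≡ᵇ b) (chainAdj (suc a) (suc b))
cartan-evenOrMinusOne D a b = simplyLaced-evenOrMinusOne (a ≡ᵇ b) (dAdj (suc a) (suc b))
cartan-evenOrMinusOne B zero zero = inj₂ (+ 1 , refl)
cartan-evenOrMinusOne B zero (suc zero) = inj₂ (- (+ 1) , refl)
cartan-evenOrMinusOne B zero (suc (suc b)) = cartan-evenOrMinusOne A zero (suc (suc b))
cartan-evenOrMinusOne B (suc zero) zero = inj₁ refl
cartan-evenOrMinusOne B (suc zero) (suc zero) = inj₂ (+ 1 , refl)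
cartan-evenOrMinusOne B (suc zero) (suc (suc b)) = cartan-evenOrMinusOne A (suc zero) (suc (suc b))
cartan-evenOrMinusOne B (suc (suc a)) b = cartan-evenOrMinusOne A (suc (suc a)) b
cartan-evenOrMinusOne C zero zero = inj₂ (+ 1 , refl)
cartan-evenOrMinusOne C zero (suc zero) = inj₁ refl
cartan-evenOrMinusOne C zero (suc (suc b)) = cartan-evenOrMinusOne A zero (suc (suc b))
cartan-evenOrMinusOne C (suc zero) zero = inj₂ (- (+ 1) , refl)
cartan-evenOrMinusOne C (suc zero) (suc zero) = inj₂ (+ 1 , refl)
cartan-evenOrMinusOne C (suc zero) (suc (suc b)) = cartan-evenOrMinusOne A (suc zero) (suc (suc b))
cartan-evenOrMinusOne C (suc (suc a)) b = cartan-evenOrMinusOne A (suc (suc a)) b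

chainCartan : ℕ → ℕ → ℤ
chainCartan a b = + 2 * δ a b - δ a (suc b) - δ (suc a) b

cartan-A : ∀ a b → cartan A a b ≡ chainCartan a b
cartan-A zero zero = refl
cartan-A zero (suc zero) = refl
cartan-A zero (suc (suc b)) = refl
cartan-A (suc zero) zero = refl
cartan-A (suc (suc a)) zero = refl
cartan-A (suc a) (suc b) = cartan-A a b

cartanCorrection : CartanType → ℕ → ℕ → ℤ
cartanCorrection A a b = + 0
cartanCorrection B a b = - (δ a 0 * δ b 1)
cartanCorrection C a b = - (δ a 1 * δ b 0)
cartanCorrection D a b = δ a 0 * δ b 1 + δ a 1 * δ b 0 - δ a 0 * δ b 2 - δ a 2 * δ b 0

cartan-chain+correction : ∀ t a b → cartan t a b ≡ chainCartan a b + cartanCorrection t a b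
cartan-chain+correction A a b = trans (cartan-A a b) (+0 _)
  where +0 : ∀ x → x ≡ x + + 0
        +0 x = sym (ℤ.+-identityʳ x)
cartan-chain+correction B zero zero = refl
cartan-chain+correction B zero (suc zero) = refl
cartan-chain+correction B zero (suc (suc b)) = refl
cartan-chain+correction B (suc zero) zero = refl
cartan-chain+correction B (suc zero) (suc b) = cartan-chain+correction A (suc zero) (suc b)
cartan-chain+correction B (suc (suc a)) b = cartan-chain+correction A (suc (suc a)) b
cartan-chain+correction C zero zero = refl
cartan-chain+correction C zero (suc zero) = refl
cartan-chain+correction C zero (suc (suc b)) = refl
cartan-chain+correction C (suc zero) zero = refl
cartan-chain+correction C (suc zero) (suc b) = cartan-chain+correction A (suc zero) (suc b)
cartan-chain+correction C (suc (suc a)) b = cartan-chain+correction A (suc (suc a)) b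
cartan-chain+correction D zero zero = refl
cartan-chain+correction D zero (suc zero) = refl
cartan-chain+correction D zero (suc (suc zero)) = refl
cartan-chain+correction D zero (suc (suc (suc b))) = refl
cartan-chain+correction D (suc zero) zero = refl
cartan-chain+correction D (suc zero) (suc zero) = refl
cartan-chain+correction D (suc zero) (suc (suc zero)) = refl
cartan-chain+correction D (suc zero) (suc (suc (suc b))) = refl
cartan-chain+correction D (suc (suc zero)) zero = refl
cartan-chain+correction D (suc (suc zero)) (suc zero) = refl
cartan-chain+correction D (suc (suc zero)) (suc (suc zero)) = refl
cartan-chain+correction D (suc (suc zero)) (suc (suc (suc b))) = cartan-chain+correction A 2 (3 ℕ.+ b)
cartan-chain+correction D (suc (suc (suc a))) zero = refl
cartan-chain+correction D (suc (suc (suc a))) (suc zero) = refl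
cartan-chain+correction D (suc (suc (suc a))) (suc (suc zero)) = cartan-chain+correction A (3 ℕ.+ a) 2
cartan-chain+correction D (suc (suc (suc a))) (suc (suc (suc b))) = cartan-chain+correction A (3 ℕ.+ a) (3 ℕ.+ b)

chainCartan-sym : ∀ a b → chainCartan a b ≡ chainCartan b a
chainCartan-sym a b rewrite δ-sym a b | δ-sym a (suc b) | δ-sym (suc a) b = swap (δ b a) (δ (suc b) a) (δ b (suc a))
  where swap : ∀ x y z → + 2 * x - y - z ≡ + 2 * x - z - y
        swap = solve-∀

cartan-A-sym : ∀ a b → cartan A a b ≡ cartan A b a
cartan-A-sym a b = trans (cartan-A a b) (trans (chainCartan-sym a b) (sym (cartan-A b a)))

cartan-D-sym : ∀ a b → cartan D a b ≡ cartan D b a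
cartan-D-sym a b = begin
  cartan D a b                                       ≡⟨ cartan-chain+correction D a b ⟩
  chainCartan a b + cartanCorrection D a b           ≡⟨ cong₂ _+_ (chainCartan-sym a b) correction-sym ⟩
  chainCartan b a + cartanCorrection D b a           ≡⟨ cartan-chain+correction D b a ⟨
  cartan D b a                                       ∎
  where
  open ≡-Reasoning
  swap : ∀ a0 a1 a2 b0 b1 b2 → a0 * b1 + a1 * b0 - a0 * b2 - a2 * b0 ≡ b0 * a1 + b1 * a0 - b0 * a2 - b2 * a0
  swap = solve-∀
  correction-sym : cartanCorrection D a b ≡ cartanCorrection D b a
  correction-sym rewrite δ-sym a 0 | δ-sym a 1 | δ-sym a 2 | δ-sym b 0 | δ-sym b 1 | δ-sym b 2 =
    swap (δ 0 a) (δ 1 a) (δ 2 a) (δ 0 b) (δ 1 b) (δ 2 b)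

cartan-B-tail : ∀ a b → cartan B (suc a) (suc b) ≡ cartan A (suc a) (suc b)
cartan-B-tail zero zero = refl
cartan-B-tail zero (suc b) = refl
cartan-B-tail (suc a) b = refl

cartan-C-tail : ∀ a b → cartan C (suc a) (suc b) ≡ cartan A (suc a) (suc b)
cartan-C-tail zero zero = refl
cartan-C-tail zero (suc b) = refl
cartan-C-tail (suc a) b = refl

symmetrizer : CartanType → ℕ → ℤ
symmetrizer B zero    = + 2
symmetrizer C (suc _) = + 2
symmetrizer _ _       = + 1

symmetrizer-pos : ∀ t a → + 0 ℤ.< symmetrizer t a
symmetrizer-pos A a       = +<+ (s≤s z≤n)
symmetrizer-pos D a       = +<+ (s≤s z≤n)
symmetrizer-pos B zero    = +<+ (s≤s z≤n)
symmetrizer-pos B (suc a) = +<+ (s≤s z≤n)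
symmetrizer-pos C zero    = +<+ (s≤s z≤n)
symmetrizer-pos C (suc a) = +<+ (s≤s z≤n)

cartan-symmetrizable : ∀ t a b → symmetrizer t a * cartan t b a ≡ symmetrizer t b * cartan t a b
cartan-symmetrizable A a b = cong (+ 1 *_) (cartan-A-sym b a)
cartan-symmetrizable D a b = cong (+ 1 *_) (cartan-D-sym b a)
cartan-symmetrizable B zero zero = refl
cartan-symmetrizable B zero (suc zero) = refl
cartan-symmetrizable B zero (suc (suc b)) = refl
cartan-symmetrizable B (suc zero) zero = refl
cartan-symmetrizable B (suc (suc a)) zero = refl
cartan-symmetrizable B (suc a) (suc b) =
  cong (+ 1 *_) (trans (cartan-B-tail b a) (trans (cartan-A-sym (suc b) (suc a)) (sym (cartan-B-tail a b))))
cartan-symmetrizable C zero zero = refl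
cartan-symmetrizable C zero (suc zero) = refl
cartan-symmetrizable C zero (suc (suc b)) = refl
cartan-symmetrizable C (suc zero) zero = refl
cartan-symmetrizable C (suc (suc a)) zero = refl
cartan-symmetrizable C (suc a) (suc b) =
  cong (+ 2 *_) (trans (cartan-C-tail b a) (trans (cartan-A-sym (suc b) (suc a)) (sym (cartan-C-tail a b))))

-- The Weyl group acting on the coroot lattice

-- An element c of Q∨ stands for Σ c_k α_k^∨.  By act-adjoint, actᵀ x is the transpose of act x:
-- it applies the letters of x from left to right, i.e. it is the inverse of x acting on Q∨.
module CorootAction (t : CartanType) {n : ℕ} where

  Q∨ : Set
  Q∨ = Fin n → ℤ

  ⟨α_,_⟩ : Fin n → Q∨ → ℤ
  ⟨α j , c ⟩ = ∑[ m < n ] (c m * pair t m j)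

  s∨ : Fin n → Q∨ → Q∨
  s∨ j c k = c k - ⟨α j , c ⟩ * fund j k

  ⟪_,_⟫ : Weight n → Q∨ → ℤ
  ⟪ μ , c ⟫ = ∑[ k < n ] (μ k * c k)

  actᵀ : Word n → Q∨ → Q∨
  actᵀ []      c = c
  actᵀ (j ∷ x) c = actᵀ x (s∨ j c)

  ⟨α⟩-cong : ∀ j {c d} → c ≗ d → ⟨α j , c ⟩ ≡ ⟨α j , d ⟩
  ⟨α⟩-cong j c≗d = sum-cong-≗ (λ m → cong (_* pair t m j) (c≗d m))

  s∨-cong : ∀ j {c d} → c ≗ d → s∨ j c ≗ s∨ j d
  s∨-cong j c≗d k = cong₂ (λ a b → a - b * fund j k) (c≗d k) (⟨α⟩-cong j c≗d)

  actᵀ-cong : ∀ x {c d} → c ≗ d → actᵀ x c ≗ actᵀ x d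
  actᵀ-cong []      c≗d = c≗d
  actᵀ-cong (j ∷ x) c≗d = actᵀ-cong x (s∨-cong j c≗d)

  ⟨α⟩-linear : ∀ j c s d → ⟨α j , (λ k → c k + s * d k) ⟩ ≡ ⟨α j , c ⟩ + s * ⟨α j , d ⟩
  ⟨α⟩-linear j c s d = trans (sum-cong-≗ (λ m → distrib (c m) s (d m) (pair t m j)))
                             (∑-linear (λ m → c m * pair t m j) s (λ m → d m * pair t m j))
    where distrib : ∀ a s b p → (a + s * b) * p ≡ a * p + s * (b * p)
          distrib = solve-∀

  ⟨α⟩-fund : ∀ j k → ⟨α k , fund j ⟩ ≡ pair t j k
  ⟨α⟩-fund j k = ∑-fundˡ (λ m → pair t m k) j

  ⟨α⟩-fund-diag : ∀ j → ⟨α j , fund j ⟩ ≡ + 2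
  ⟨α⟩-fund-diag j = trans (⟨α⟩-fund j j) (cartan-diag t (toℕ j))

  s∨-as-linear : ∀ j c → s∨ j c ≗ (λ k → c k + (- ⟨α j , c ⟩) * fund j k)
  s∨-as-linear j c k = minus (c k) ⟨α j , c ⟩ (fund j k)
    where minus : ∀ a x f → a - x * f ≡ a + (- x) * f
          minus = solve-∀

  s∨-linear : ∀ j c s d → s∨ j (λ k → c k + s * d k) ≗ (λ k → s∨ j c k + s * s∨ j d k)
  s∨-linear j c s d k rewrite ⟨α⟩-linear j c s d = distrib (c k) s (d k) ⟨α j , c ⟩ ⟨α j , d ⟩ (fund j k)
    where distrib : ∀ a s b x y f → a + s * b - (x + s * y) * f ≡ a - x * f + s * (b - y * f)
          distrib = solve-∀

  actᵀ-linear : ∀ x c s d → actᵀ x (λ k → c k + s * d k) ≗ (λ k → actᵀ x c k + s * actᵀ x d k)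
  actᵀ-linear []      c s d k = refl
  actᵀ-linear (j ∷ x) c s d k =
    trans (actᵀ-cong x (s∨-linear j c s d) k) (actᵀ-linear x (s∨ j c) s (s∨ j d) k)

  actᵀ-zero : ∀ x → actᵀ x (λ _ → + 0) ≗ (λ _ → + 0)
  actᵀ-zero []      k = refl
  actᵀ-zero (j ∷ x) k =
    trans (actᵀ-cong x (λ k′ → cong (λ a → + 0 - a * fund j k′) (sum-replicate-zero n)) k) (actᵀ-zero x k)

  actᵀ-scale : ∀ x s d → actᵀ x (λ k → s * d k) ≗ (λ k → s * actᵀ x d k)
  actᵀ-scale x s d k = begin
    actᵀ x (λ k → s * d k) k               ≡⟨ actᵀ-cong x (λ k′ → sym (ℤ.+-identityˡ (s * d k′))) k ⟩
    actᵀ x (λ k → + 0 + s * d k) k         ≡⟨ actᵀ-linear x (λ _ → + 0) s d k ⟩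
    actᵀ x (λ _ → + 0) k + s * actᵀ x d k  ≡⟨ cong (_+ s * actᵀ x d k) (actᵀ-zero x k) ⟩
    + 0 + s * actᵀ x d k                   ≡⟨ ℤ.+-identityˡ (s * actᵀ x d k) ⟩
    s * actᵀ x d k                         ∎
    where open ≡-Reasoning

  ⟪⟫-cong : ∀ μ {c d} → c ≗ d → ⟪ μ , c ⟫ ≡ ⟪ μ , d ⟫
  ⟪⟫-cong μ c≗d = sum-cong-≗ (λ k → cong (μ k *_) (c≗d k))

  s-adjoint : ∀ j μ c → ⟪ refl-s t j μ , c ⟫ ≡ ⟪ μ , s∨ j c ⟫
  s-adjoint j μ c = begin
    ∑[ k < n ] ((μ k - μ j * pair t k j) * c k)
      ≡⟨ sum-cong-≗ (λ k → expandˡ (μ k) (μ j) (pair t k j) (c k)) ⟩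
    ∑[ k < n ] (μ k * c k + (- μ j) * (c k * pair t k j))
      ≡⟨ ∑-linear (λ k → μ k * c k) (- μ j) (λ k → c k * pair t k j) ⟩
    ⟪ μ , c ⟫ + (- μ j) * ⟨α j , c ⟩
      ≡⟨ cong (λ a → ⟪ μ , c ⟫ + (- a) * ⟨α j , c ⟩) (sym (∑-fundʳ μ j)) ⟩
    ⟪ μ , c ⟫ + (- ∑[ k < n ] (μ k * fund j k)) * ⟨α j , c ⟩
      ≡⟨ swap ⟪ μ , c ⟫ (∑[ k < n ] (μ k * fund j k)) ⟨α j , c ⟩ ⟩
    ⟪ μ , c ⟫ + (- ⟨α j , c ⟩) * ∑[ k < n ] (μ k * fund j k)
      ≡⟨ ∑-linear (λ k → μ k * c k) (- ⟨α j , c ⟩) (λ k → μ k * fund j k) ⟨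
    ∑[ k < n ] (μ k * c k + (- ⟨α j , c ⟩) * (μ k * fund j k))
      ≡⟨ sum-cong-≗ (λ k → expandʳ (μ k) (c k) ⟨α j , c ⟩ (fund j k)) ⟩
    ⟪ μ , s∨ j c ⟫ ∎
    where
    open ≡-Reasoning
    expandˡ : ∀ a b p c → (a - b * p) * c ≡ a * c + (- b) * (c * p)
    expandˡ = solve-∀
    swap : ∀ P x y → P + (- x) * y ≡ P + (- y) * x
    swap = solve-∀
    expandʳ : ∀ a c x f → a * c + (- x) * (a * f) ≡ a * (c - x * f)
    expandʳ = solve-∀

  act-adjoint : ∀ x μ c → ⟪ act t x μ , c ⟫ ≡ ⟪ μ , actᵀ x c ⟫
  act-adjoint []      μ c = refl
  act-adjoint (j ∷ x) μ c = trans (s-adjoint j (act t x μ) c) (act-adjoint x μ (s∨ j c))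

  act-coordinate : ∀ x μ k → act t x μ k ≡ ⟪ μ , actᵀ x (fund k) ⟫
  act-coordinate x μ k = trans (sym (∑-fundʳ (act t x μ) k)) (act-adjoint x μ (fund k))

  actᵀ-coordinate : ∀ x c k → actᵀ x c k ≡ ⟪ act t x (fund k) , c ⟫
  actᵀ-coordinate x c k = trans (sym (∑-fundˡ (actᵀ x c) k)) (sym (act-adjoint x (fund k) c))

  SameElt⇒actᵀ : ∀ x y → SameElt t x y → ∀ c → actᵀ x c ≗ actᵀ y c
  SameElt⇒actᵀ x y x~y c k = begin
    actᵀ x c k                                  ≡⟨ actᵀ-coordinate x c k ⟩
    ∑[ m < n ] (act t x (fund k) m * c m)       ≡⟨ sum-cong-≗ (λ m → cong (_* c m) (x~y (fund k) m)) ⟩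
    ∑[ m < n ] (act t y (fund k) m * c m)       ≡⟨ actᵀ-coordinate y c k ⟨
    actᵀ y c k                                  ∎
    where open ≡-Reasoning

  actᵀ⇒SameElt : ∀ x y → (∀ c → actᵀ x c ≗ actᵀ y c) → SameElt t x y
  actᵀ⇒SameElt x y x~y μ k = begin
    act t x μ k                     ≡⟨ act-coordinate x μ k ⟩
    ⟪ μ , actᵀ x (fund k) ⟫         ≡⟨ ⟪⟫-cong μ (x~y (fund k)) ⟩
    ⟪ μ , actᵀ y (fund k) ⟫         ≡⟨ act-coordinate y μ k ⟨
    act t y μ k                     ∎
    where open ≡-Reasoning

  ⟨α⟩-s∨-diag : ∀ j c → ⟨α j , s∨ j c ⟩ ≡ - ⟨α j , c ⟩
  ⟨α⟩-s∨-diag j c = begin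
    ⟨α j , s∨ j c ⟩                                    ≡⟨ ⟨α⟩-cong j (s∨-as-linear j c) ⟩
    ⟨α j , (λ k → c k + (- ⟨α j , c ⟩) * fund j k) ⟩   ≡⟨ ⟨α⟩-linear j c (- ⟨α j , c ⟩) (fund j) ⟩
    ⟨α j , c ⟩ + (- ⟨α j , c ⟩) * ⟨α j , fund j ⟩      ≡⟨ cong (λ a → ⟨α j , c ⟩ + (- ⟨α j , c ⟩) * a) (⟨α⟩-fund-diag j) ⟩
    ⟨α j , c ⟩ + (- ⟨α j , c ⟩) * + 2                  ≡⟨ negate ⟨α j , c ⟩ ⟩
    - ⟨α j , c ⟩                                       ∎
    where
    open ≡-Reasoning
    negate : ∀ x → x + (- x) * + 2 ≡ - x
    negate = solve-∀

  s∨-involutive : ∀ j c → s∨ j (s∨ j c) ≗ c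
  s∨-involutive j c k rewrite ⟨α⟩-s∨-diag j c = cancel (c k) ⟨α j , c ⟩ (fund j k)
    where cancel : ∀ a x f → a - x * f - (- x) * f ≡ a
          cancel = solve-∀

  s∨-fund-diag : ∀ j → s∨ j (fund j) ≗ (λ k → - (+ 1) * fund j k)
  s∨-fund-diag j k = trans (cong (λ a → fund j k - a * fund j k) (⟨α⟩-fund-diag j)) (negate (fund j k))
    where negate : ∀ f → f - + 2 * f ≡ - (+ 1) * f
          negate = solve-∀

  actᵀ-++ : ∀ x y c → actᵀ (x ++ y) c ≡ actᵀ y (actᵀ x c)
  actᵀ-++ []      y c = refl
  actᵀ-++ (j ∷ x) y c = actᵀ-++ x y (s∨ j c)

  actᵀ-reverseˡ : ∀ x c → actᵀ (reverse x) (actᵀ x c) ≗ c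
  actᵀ-reverseˡ []      c k = refl
  actᵀ-reverseˡ (j ∷ x) c k = begin
    actᵀ (reverse (j ∷ x)) (actᵀ x (s∨ j c)) k      ≡⟨ cong (λ z → actᵀ z (actᵀ x (s∨ j c)) k) (List.unfold-reverse j x) ⟩
    actᵀ (reverse x ++ j ∷ []) (actᵀ x (s∨ j c)) k  ≡⟨ cong (λ f → f k) (actᵀ-++ (reverse x) (j ∷ []) (actᵀ x (s∨ j c))) ⟩
    s∨ j (actᵀ (reverse x) (actᵀ x (s∨ j c))) k      ≡⟨ s∨-cong j (actᵀ-reverseˡ x (s∨ j c)) k ⟩
    s∨ j (s∨ j c) k                                  ≡⟨ s∨-involutive j c k ⟩
    c k                                              ∎
    where open ≡-Reasoning

  actᵀ-reverseʳ : ∀ x c → actᵀ x (actᵀ (reverse x) c) ≗ c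
  actᵀ-reverseʳ x c k =
    trans (cong (λ z → actᵀ z (actᵀ (reverse x) c) k) (sym (List.reverse-involutive x)))
          (actᵀ-reverseˡ (reverse x) c k)

  actᵀ-reverse-cong : ∀ x y → (∀ c → actᵀ x c ≗ actᵀ y c) → ∀ c → actᵀ (reverse x) c ≗ actᵀ (reverse y) c
  actᵀ-reverse-cong x y x~y c k = begin
    actᵀ (reverse x) c k                                    ≡⟨ actᵀ-cong (reverse x) (λ k′ → sym (actᵀ-reverseʳ y c k′)) k ⟩
    actᵀ (reverse x) (actᵀ y (actᵀ (reverse y) c)) k        ≡⟨ actᵀ-cong (reverse x) (λ k′ → sym (x~y (actᵀ (reverse y) c) k′)) k ⟩
    actᵀ (reverse x) (actᵀ x (actᵀ (reverse y) c)) k        ≡⟨ actᵀ-reverseˡ x (actᵀ (reverse y) c) k ⟩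
    actᵀ (reverse y) c k                                    ∎
    where open ≡-Reasoning

  Nonneg : Q∨ → Set
  Nonneg c = ∀ k → + 0 ℤ.≤ c k

  s∨-off : ∀ {j k} c → j ≢ k → s∨ j c k ≡ c k
  s∨-off {j} {k} c j≢k rewrite fund-off j≢k = trans (cong (_+_ (c k)) (cong -_ (ℤ.*-zeroʳ ⟨α j , c ⟩))) (ℤ.+-identityʳ (c k))

  ⟨α⟩≤2* : ∀ {c} → Nonneg c → ∀ m → ⟨α m , c ⟩ ℤ.≤ + 2 * c m
  ⟨α⟩≤2* {c} c≥0 m = subst (⟨α m , c ⟩ ℤ.≤_) (∑-fundʳ (λ x → + 2 * c x) m) (∑-mono-≤ termwise)
    where
    regroup : ∀ a b → a * (+ 2 * b) ≡ (+ 2 * a) * b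
    regroup = solve-∀
    termwise : ∀ x → c x * pair t x m ℤ.≤ (+ 2 * c x) * fund m x
    termwise x = subst (c x * pair t x m ℤ.≤_)
      (trans (regroup (c x) (δ (toℕ x) (toℕ m))) (cong ((+ 2 * c x) *_) (δ-sym (toℕ x) (toℕ m))))
      (ℤ.*-monoˡ-≤-nonNeg (c x) {{ℤ.nonNegative (c≥0 x)}} (cartan-offDiag t (toℕ x) (toℕ m)))

  record FirstNegativeStep (z : Word n) (c : Q∨) : Set where
    field
      before : Word n
      letter : Fin n
      after  : Word n
      split  : z ≡ before ++ letter ∷ after
      nonneg : Nonneg (actᵀ before c)
      flips  : s∨ letter (actᵀ before c) letter ℤ.< + 0

  first-negative-step : ∀ z {c} → Nonneg c → (∃[ k ] actᵀ z c k ℤ.< + 0) → FirstNegativeStep z c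
  first-negative-step []      c≥0 (k , ck<0) = ⊥-elim (ℤ.≤⇒≯ (c≥0 k) ck<0)
  first-negative-step (m ∷ z) {c} c≥0 negative with + 0 ℤ.≤? s∨ m c m
  ... | no  s∨c≱0 = record { before = [] ; letter = m ; after = z ; split = refl ; nonneg = c≥0 ; flips = ℤ.≰⇒> s∨c≱0 }
  ... | yes s∨c≥0 = record { FirstNegativeStep later ; before = m ∷ before later ; split = cong (m ∷_) (split later) }
    where
    open FirstNegativeStep
    s∨c-nonneg : Nonneg (s∨ m c)
    s∨c-nonneg k with m Fin.≟ k
    ... | yes refl = s∨c≥0
    ... | no  m≢k  = subst (+ 0 ℤ.≤_) (sym (s∨-off c m≢k)) (c≥0 k)
    later : FirstNegativeStep z (s∨ m c)
    later = first-negative-step z s∨c-nonneg negative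

-- The invariant form on the coroot lattice

module InvariantForm (t : CartanType) {n : ℕ} where

  open CorootAction t {n}

  ε : Fin n → ℤ
  ε k = symmetrizer t (toℕ k)

  form : Q∨ → Q∨ → ℤ
  form c d = ∑[ k < n ] (ε k * c k * ⟨α k , d ⟩)

  form-sym : ∀ c d → form c d ≡ form d c
  form-sym c d = begin
    ∑[ k < n ] (ε k * c k * ⟨α k , d ⟩)
      ≡⟨ sum-cong-≗ (λ k → *-distribˡ-sum (ε k * c k) (λ m → d m * pair t m k)) ⟩
    ∑[ k < n ] ∑[ m < n ] (ε k * c k * (d m * pair t m k))
      ≡⟨ sum-cong-≗ (λ k → sum-cong-≗ (λ m → symmetric k m)) ⟩
    ∑[ k < n ] ∑[ m < n ] (ε m * d m * (c k * pair t k m))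
      ≡⟨ ∑-comm (λ k m → ε m * d m * (c k * pair t k m)) ⟩
    ∑[ m < n ] ∑[ k < n ] (ε m * d m * (c k * pair t k m))
      ≡⟨ sum-cong-≗ (λ m → *-distribˡ-sum (ε m * d m) (λ k → c k * pair t k m)) ⟨
    ∑[ m < n ] (ε m * d m * ⟨α m , c ⟩) ∎
    where
    open ≡-Reasoning
    regroupˡ : ∀ ek ck dm a → ek * ck * (dm * a) ≡ ck * dm * (ek * a)
    regroupˡ = solve-∀
    regroupʳ : ∀ em dm ck a → ck * dm * (em * a) ≡ em * dm * (ck * a)
    regroupʳ = solve-∀
    symmetric : ∀ k m → ε k * c k * (d m * pair t m k) ≡ ε m * d m * (c k * pair t k m)
    symmetric k m = trans (regroupˡ (ε k) (c k) (d m) (pair t m k))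
      (trans (cong (c k * d m *_) (cartan-symmetrizable t (toℕ k) (toℕ m)))
             (regroupʳ (ε m) (d m) (c k) (pair t k m)))

  form-cong : ∀ {c c′ d d′} → c ≗ c′ → d ≗ d′ → form c d ≡ form c′ d′
  form-cong c≗c′ d≗d′ = sum-cong-≗ (λ k → cong₂ (λ a b → ε k * a * b) (c≗c′ k) (⟨α⟩-cong k d≗d′))

  form-congˡ : ∀ {c c′} d → c ≗ c′ → form c d ≡ form c′ d
  form-congˡ d c≗c′ = form-cong {d = d} c≗c′ (λ _ → refl)

  form-linearˡ : ∀ c s d e → form (λ k → c k + s * d k) e ≡ form c e + s * form d e
  form-linearˡ c s d e = trans (sum-cong-≗ (λ k → distrib (ε k) (c k) s (d k) ⟨α k , e ⟩))
                               (∑-linear (λ k → ε k * c k * ⟨α k , e ⟩) s (λ k → ε k * d k * ⟨α k , e ⟩))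
    where distrib : ∀ ek c s d l → ek * (c + s * d) * l ≡ ek * c * l + s * (ek * d * l)
          distrib = solve-∀

  form-fundˡ : ∀ j d → form (fund j) d ≡ ε j * ⟨α j , d ⟩
  form-fundˡ j d = trans (sum-cong-≗ (λ k → regroup (ε k) (fund j k) ⟨α k , d ⟩)) (∑-fundˡ (λ k → ε k * ⟨α k , d ⟩) j)
    where regroup : ∀ e f l → e * f * l ≡ f * (e * l)
          regroup = solve-∀

  form-fund-diag : ∀ j → form (fund j) (fund j) ≡ ε j * + 2
  form-fund-diag j = trans (form-fundˡ j (fund j)) (cong (ε j *_) (⟨α⟩-fund-diag j))

  form-s∨ : ∀ j c d → form (s∨ j c) (s∨ j d) ≡ form c d
  form-s∨ j c d = begin
    form (s∨ j c) (s∨ j d)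
      ≡⟨ form-congˡ (s∨ j d) (s∨-as-linear j c) ⟩
    form (λ k → c k + (- a) * fund j k) (s∨ j d)
      ≡⟨ form-linearˡ c (- a) (fund j) (s∨ j d) ⟩
    form c (s∨ j d) + (- a) * form (fund j) (s∨ j d)
      ≡⟨ cong₂ (λ u v → u + (- a) * v) form-c-s∨d (trans (form-fundˡ j (s∨ j d)) (cong (ε j *_) (⟨α⟩-s∨-diag j d))) ⟩
    (form c d + (- b) * (ε j * a)) + (- a) * (ε j * (- b))
      ≡⟨ cancel (form c d) a b (ε j) ⟩
    form c d ∎
    where
    open ≡-Reasoning
    a = ⟨α j , c ⟩
    b = ⟨α j , d ⟩
    cancel : ∀ P a b e → (P + (- b) * (e * a)) + (- a) * (e * (- b)) ≡ P
    cancel = solve-∀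
    form-c-s∨d : form c (s∨ j d) ≡ form c d + (- b) * (ε j * a)
    form-c-s∨d = begin
      form c (s∨ j d)                                 ≡⟨ form-sym c (s∨ j d) ⟩
      form (s∨ j d) c                                 ≡⟨ form-congˡ c (s∨-as-linear j d) ⟩
      form (λ k → d k + (- b) * fund j k) c           ≡⟨ form-linearˡ d (- b) (fund j) c ⟩
      form d c + (- b) * form (fund j) c              ≡⟨ cong₂ (λ u v → u + (- b) * v) (form-sym d c) (form-fundˡ j c) ⟩
      form c d + (- b) * (ε j * a)                    ∎

  form-actᵀ : ∀ x c d → form (actᵀ x c) (actᵀ x d) ≡ form c d
  form-actᵀ []      c d = refl
  form-actᵀ (j ∷ x) c d = trans (form-actᵀ x (s∨ j c) (s∨ j d)) (form-s∨ j c d)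

  DivisibleBy : Fin n → Q∨ → Set
  DivisibleBy j c = ∀ k → ∃[ q ] ε k * c k ≡ ε j * q

  ε-fund : ∀ m k → ε k * fund m k ≡ ε m * fund m k
  ε-fund m k with m Fin.≟ k
  ... | yes refl = refl
  ... | no m≢k rewrite fund-off m≢k = trans (ℤ.*-zeroʳ (ε k)) (sym (ℤ.*-zeroʳ (ε m)))

  fund-divisible : ∀ j → DivisibleBy j (fund j)
  fund-divisible j k = fund j k , ε-fund j k

  divisible-⟨α⟩ : ∀ {j c} → DivisibleBy j c → ∀ m → ∃[ S ] ε m * ⟨α m , c ⟩ ≡ ε j * S
  divisible-⟨α⟩ {j} {c} j∣c m = S , (begin
    ε m * ∑[ x < n ] (c x * pair t x m)       ≡⟨ *-distribˡ-sum (ε m) (λ x → c x * pair t x m) ⟩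
    ∑[ x < n ] (ε m * (c x * pair t x m))     ≡⟨ sum-cong-≗ termwise ⟩
    ∑[ x < n ] (ε j * (q x * pair t m x))     ≡⟨ *-distribˡ-sum (ε j) (λ x → q x * pair t m x) ⟨
    ε j * S                                   ∎)
    where
    open ≡-Reasoning
    q : Fin n → ℤ
    q x = proj₁ (j∣c x)
    S = ∑[ x < n ] (q x * pair t m x)
    regroupˡ : ∀ em cx a → em * (cx * a) ≡ cx * (em * a)
    regroupˡ = solve-∀
    regroupʳ : ∀ ex cx a → cx * (ex * a) ≡ (ex * cx) * a
    regroupʳ = solve-∀
    termwise : ∀ x → ε m * (c x * pair t x m) ≡ ε j * (q x * pair t m x)
    termwise x = begin
      ε m * (c x * pair t x m)      ≡⟨ regroupˡ (ε m) (c x) (pair t x m) ⟩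
      c x * (ε m * pair t x m)      ≡⟨ cong (c x *_) (cartan-symmetrizable t (toℕ m) (toℕ x)) ⟩
      c x * (ε x * pair t m x)      ≡⟨ regroupʳ (ε x) (c x) (pair t m x) ⟩
      (ε x * c x) * pair t m x      ≡⟨ cong (_* pair t m x) (proj₂ (j∣c x)) ⟩
      (ε j * q x) * pair t m x      ≡⟨ ℤ.*-assoc (ε j) (q x) (pair t m x) ⟩
      ε j * (q x * pair t m x)      ∎

  divisible-s∨ : ∀ {j c} m → DivisibleBy j c → DivisibleBy j (s∨ m c)
  divisible-s∨ {j} {c} m j∣c k with j∣c k | divisible-⟨α⟩ j∣c m
  ... | q , εc≡εq | S , εL≡εS = q - fund m k * S , (begin
    ε k * (c k - L * fund m k)        ≡⟨ expand (ε k) (c k) L (fund m k) ⟩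
    ε k * c k - L * (ε k * fund m k)  ≡⟨ cong₂ (λ u v → u - L * v) εc≡εq (ε-fund m k) ⟩
    ε j * q - L * (ε m * fund m k)    ≡⟨ regroup (ε j) q L (ε m) (fund m k) ⟩
    ε j * q - (ε m * L) * fund m k    ≡⟨ cong (λ z → ε j * q - z * fund m k) εL≡εS ⟩
    ε j * q - (ε j * S) * fund m k    ≡⟨ factor (ε j) q S (fund m k) ⟩
    ε j * (q - fund m k * S)          ∎)
    where
    open ≡-Reasoning
    L = ⟨α m , c ⟩
    expand : ∀ e c l f → e * (c - l * f) ≡ e * c - l * (e * f)
    expand = solve-∀
    regroup : ∀ ej q l em f → ej * q - l * (em * f) ≡ ej * q - (em * l) * f
    regroup = solve-∀
    factor : ∀ ej q s f → ej * q - (ej * s) * f ≡ ej * (q - f * s)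
    factor = solve-∀

  divisible-actᵀ : ∀ {j c} x → DivisibleBy j c → DivisibleBy j (actᵀ x c)
  divisible-actᵀ []      j∣c = j∣c
  divisible-actᵀ (m ∷ x) j∣c = divisible-actᵀ x (divisible-s∨ m j∣c)

  form-add-simple : ∀ c s m → form (λ k → c k + s * fund m k) (λ k → c k + s * fund m k)
                                ≡ form c c + + 2 * s * (ε m * ⟨α m , c ⟩) + + 2 * (s * s) * ε m
  form-add-simple c s m = begin
    form c′ c′                                              ≡⟨ form-linearˡ c s (fund m) c′ ⟩
    form c c′ + s * form (fund m) c′                         ≡⟨ cong₂ (λ a b → a + s * b) form-c-c′ (form-fundˡ m c′) ⟩
    form c c + s * (ε m * ⟨α m , c ⟩) + s * (ε m * ⟨α m , c′ ⟩)
      ≡⟨ cong (λ a → form c c + s * (ε m * ⟨α m , c ⟩) + s * (ε m * a))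
              (trans (⟨α⟩-linear m c s (fund m)) (cong (λ a → ⟨α m , c ⟩ + s * a) (⟨α⟩-fund-diag m))) ⟩
    form c c + s * (ε m * ⟨α m , c ⟩) + s * (ε m * (⟨α m , c ⟩ + s * + 2))
      ≡⟨ collect (form c c) s (ε m) ⟨α m , c ⟩ ⟩
    form c c + + 2 * s * (ε m * ⟨α m , c ⟩) + + 2 * (s * s) * ε m ∎
    where
    open ≡-Reasoning
    c′ : Q∨
    c′ k = c k + s * fund m k
    form-c-c′ : form c c′ ≡ form c c + s * (ε m * ⟨α m , c ⟩)
    form-c-c′ = begin
      form c c′                          ≡⟨ form-sym c c′ ⟩
      form c′ c                          ≡⟨ form-linearˡ c s (fund m) c ⟩
      form c c + s * form (fund m) c     ≡⟨ cong (λ a → form c c + s * a) (form-fundˡ m c) ⟩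
      form c c + s * (ε m * ⟨α m , c ⟩)  ∎
    collect : ∀ Q s e L → Q + s * (e * L) + s * (e * (L + s * + 2)) ≡ Q + + 2 * s * (e * L) + + 2 * (s * s) * e
    collect = solve-∀

  PositiveDefinite : Set
  PositiveDefinite = ∀ d → form d d ℤ.≤ + 0 → ∀ k → d k ≡ + 0

∑ℕ : ℕ → (ℕ → ℤ) → ℤ
∑ℕ N g = ∑[ k < N ] g (toℕ k)

∑ℕ-cong : ∀ N {f g} → (∀ ℓ → ℓ < N → f ℓ ≡ g ℓ) → ∑ℕ N f ≡ ∑ℕ N g
∑ℕ-cong N f≗g = sum-cong-≗ (λ k → f≗g (toℕ k) (Fin.toℕ<n k))

∑ℕ-snoc : ∀ N g → ∑ℕ (suc N) g ≡ ∑ℕ N g + g N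
∑ℕ-snoc N g = trans (sum-init-last {N} (g ∘ toℕ))
  (cong₂ _+_ (sum-cong-≗ {N} (cong g ∘ Fin.toℕ-inject₁)) (cong g (Fin.toℕ-fromℕ N)))

∑ℕ-linear : ∀ N f s g → ∑ℕ N (λ ℓ → f ℓ + s * g ℓ) ≡ ∑ℕ N f + s * ∑ℕ N g
∑ℕ-linear N f s g = ∑-linear {N} (f ∘ toℕ) s (g ∘ toℕ)

VanishesFrom : ℕ → (ℕ → ℤ) → Set
VanishesFrom N z = ∀ ℓ → N ℕ.≤ ℓ → z ℓ ≡ + 0

vanishesFrom-* : ∀ {N z} (g : ℕ → ℤ) → VanishesFrom N z → VanishesFrom N (λ ℓ → z ℓ * g ℓ)
vanishesFrom-* g z≡0 ℓ N≤ℓ = trans (cong (_* g ℓ) (z≡0 ℓ N≤ℓ)) (ℤ.*-zeroˡ (g ℓ))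

∑ℕ-δ : ∀ N z p → VanishesFrom N z → ∑ℕ N (λ ℓ → z ℓ * δ ℓ p) ≡ z p
∑ℕ-δ zero    z p       z≡0 = sym (z≡0 p z≤n)
∑ℕ-δ (suc N) z zero    z≡0 = begin
  z 0 * + 1 + ∑ℕ N (λ ℓ → z (suc ℓ) * + 0)
    ≡⟨ cong₂ _+_ (ℤ.*-identityʳ (z 0)) (trans (sum-cong-≗ {N} (ℤ.*-zeroʳ ∘ z ∘ suc ∘ toℕ)) (sum-replicate-zero N)) ⟩
  z 0 + + 0                                  ≡⟨ ℤ.+-identityʳ (z 0) ⟩
  z 0                                        ∎
  where open ≡-Reasoning
∑ℕ-δ (suc N) z (suc p) z≡0 =
  trans (cong (_+ ∑ℕ N (λ ℓ → z (suc ℓ) * δ ℓ p)) (ℤ.*-zeroʳ (z 0)))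
        (trans (ℤ.+-identityˡ _) (∑ℕ-δ N (z ∘ suc) p (λ ℓ N≤ℓ → z≡0 (suc ℓ) (s≤s N≤ℓ))))

∑ℕ-peel : ∀ N f s z p → VanishesFrom N z → ∑ℕ N (λ ℓ → f ℓ + s * (z ℓ * δ ℓ p)) ≡ ∑ℕ N f + s * z p
∑ℕ-peel N f s z p z≡0 =
  trans (∑ℕ-linear N f s (λ ℓ → z ℓ * δ ℓ p)) (cong (λ a → ∑ℕ N f + s * a) (∑ℕ-δ N z p z≡0))

prev : (ℕ → ℤ) → ℕ → ℤ
prev z zero    = + 0
prev z (suc p) = z p

∑ℕ-δ-suc : ∀ N z p → VanishesFrom N z → ∑ℕ N (λ ℓ → z ℓ * δ (suc ℓ) p) ≡ prev z p
∑ℕ-δ-suc N z zero    _   = trans (sum-cong-≗ {N} (ℤ.*-zeroʳ ∘ z ∘ toℕ)) (sum-replicate-zero N)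
∑ℕ-δ-suc N z (suc p) z≡0 = ∑ℕ-δ N z p z≡0

∑ℕ-squares-nonneg : ∀ N (y : ℕ → ℤ) → + 0 ℤ.≤ ∑ℕ N (λ ℓ → y ℓ * y ℓ)
∑ℕ-squares-nonneg zero    y = +≤+ z≤n
∑ℕ-squares-nonneg (suc N) y = ℤ.+-mono-≤ (square-nonneg (y 0)) (∑ℕ-squares-nonneg N (y ∘ suc))

∑ℕ-squares≤0 : ∀ N (y : ℕ → ℤ) → ∑ℕ N (λ ℓ → y ℓ * y ℓ) ℤ.≤ + 0 → ∀ ℓ → ℓ < N → y ℓ ≡ + 0
∑ℕ-squares≤0 (suc N) y ∑≤0 ℓ ℓ<N
  with nonneg-+≤0 {y 0 * y 0} (square-nonneg (y 0)) (∑ℕ-squares-nonneg N (y ∘ suc)) ∑≤0 | ℓ | ℓ<N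
... | y0²≤0 , _     | zero  | _         = square≤0⇒≡0 (y 0) y0²≤0
... | _     , rest≤0 | suc ℓ | s≤s ℓ<N′ = ∑ℕ-squares≤0 N (y ∘ suc) rest≤0 ℓ ℓ<N′

∑Δ² : ℕ → (ℕ → ℤ) → ℤ
∑Δ² N y = ∑ℕ N (λ ℓ → (y ℓ - y (suc ℓ)) * (y ℓ - y (suc ℓ)))

∑Δ²-nonneg : ∀ N (y : ℕ → ℤ) → + 0 ℤ.≤ ∑Δ² N y
∑Δ²-nonneg N y = ∑ℕ-squares-nonneg N (λ ℓ → y ℓ - y (suc ℓ))

∑Δ²≤0 : ∀ N (y : ℕ → ℤ) → ∑Δ² N y ℤ.≤ + 0 → y N ≡ + 0 → ∀ ℓ → ℓ ℕ.≤ N → y ℓ ≡ + 0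
∑Δ²≤0 N y ∑≤0 = constant N y (∑ℕ-squares≤0 N (λ ℓ → y ℓ - y (suc ℓ)) ∑≤0)
  where
  constant : ∀ N (y : ℕ → ℤ) → (∀ ℓ → ℓ < N → y ℓ - y (suc ℓ) ≡ + 0) →
             y N ≡ + 0 → ∀ ℓ → ℓ ℕ.≤ N → y ℓ ≡ + 0
  constant zero    y _   y0≡0 zero    _         = y0≡0
  constant (suc N) y Δ≡0 yN≡0 zero    _         =
    trans (ℤ.i-j≡0⇒i≡j (y 0) (y 1) (Δ≡0 0 (s≤s z≤n))) (constant N (y ∘ suc) (λ ℓ → Δ≡0 (suc ℓ) ∘ s≤s) yN≡0 0 z≤n)
  constant (suc N) y Δ≡0 yN≡0 (suc ℓ) (s≤s ℓ≤N) = constant N (y ∘ suc) (λ ℓ → Δ≡0 (suc ℓ) ∘ s≤s) yN≡0 ℓ ℓ≤N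

chainRow : (ℕ → ℤ) → ℕ → ℤ
chainRow x ℓ = + 2 * x ℓ - x (suc ℓ) - prev x ℓ

∑ℕ-chain : ∀ N (x : ℕ → ℤ) →
  ∑ℕ N (λ ℓ → x ℓ * chainRow x ℓ) ≡ x 0 * x 0 + ∑Δ² N x - x N * x N + x N * prev x N
∑ℕ-chain zero    x = boundary (x 0)
  where boundary : ∀ a → + 0 ≡ a * a + + 0 - a * a + a * + 0
        boundary = solve-∀
∑ℕ-chain (suc N) x = begin
  ∑ℕ (suc N) (λ ℓ → x ℓ * chainRow x ℓ)
    ≡⟨ ∑ℕ-snoc N (λ ℓ → x ℓ * chainRow x ℓ) ⟩
  ∑ℕ N (λ ℓ → x ℓ * chainRow x ℓ) + x N * chainRow x N
    ≡⟨ cong (_+ x N * chainRow x N) (∑ℕ-chain N x) ⟩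
  x 0 * x 0 + ∑Δ² N x - x N * x N + x N * prev x N + x N * (+ 2 * x N - x (suc N) - prev x N)
    ≡⟨ step (x 0) (∑Δ² N x) (x N) (x (suc N)) (prev x N) ⟩
  x 0 * x 0 + (∑Δ² N x + (x N - x (suc N)) * (x N - x (suc N))) - x (suc N) * x (suc N) + x (suc N) * x N
    ≡⟨ cong (λ s → x 0 * x 0 + s - x (suc N) * x (suc N) + x (suc N) * x N)
            (∑ℕ-snoc N (λ ℓ → (x ℓ - x (suc ℓ)) * (x ℓ - x (suc ℓ)))) ⟨
  x 0 * x 0 + ∑Δ² (suc N) x - x (suc N) * x (suc N) + x (suc N) * prev x (suc N) ∎
  where
  open ≡-Reasoning
  step : ∀ x0 S a b p → x0 * x0 + S - a * a + a * p + a * (+ 2 * a - b - p)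
                      ≡ x0 * x0 + (S + (a - b) * (a - b)) - b * b + b * a
  step = solve-∀

∑ℕ-chain-vanishing : ∀ N (x : ℕ → ℤ) → x N ≡ + 0 → ∑ℕ N (λ ℓ → x ℓ * chainRow x ℓ) ≡ x 0 * x 0 + ∑Δ² N x
∑ℕ-chain-vanishing N x xN≡0 rewrite ∑ℕ-chain N x | xN≡0 = vanish (x 0 * x 0 + ∑Δ² N x) (prev x N)
  where vanish : ∀ h p → h - + 0 * + 0 + + 0 * p ≡ h
        vanish = solve-∀

zeroExtend : ∀ {n} → (Fin n → ℤ) → ℕ → ℤ
zeroExtend {zero}  d ℓ       = + 0
zeroExtend {suc n} d zero    = d zero
zeroExtend {suc n} d (suc ℓ) = zeroExtend (d ∘ suc) ℓ

zeroExtend-toℕ : ∀ {n} (d : Fin n → ℤ) k → zeroExtend d (toℕ k) ≡ d k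
zeroExtend-toℕ {suc n} d zero    = refl
zeroExtend-toℕ {suc n} d (suc k) = zeroExtend-toℕ (d ∘ suc) k

zeroExtend-vanishes : ∀ {n} (d : Fin n → ℤ) → VanishesFrom n (zeroExtend d)
zeroExtend-vanishes {zero}  d ℓ       _         = refl
zeroExtend-vanishes {suc n} d (suc ℓ) (s≤s n≤ℓ) = zeroExtend-vanishes (d ∘ suc) ℓ n≤ℓ

correctionRow : CartanType → (ℕ → ℤ) → ℕ → ℤ
correctionRow A x ℓ = + 0
correctionRow B x ℓ = - (x 0 * δ ℓ 1)
correctionRow C x ℓ = - (x 1 * δ ℓ 0)
correctionRow D x ℓ = x 0 * δ ℓ 1 + x 1 * δ ℓ 0 - x 0 * δ ℓ 2 - x 2 * δ ℓ 0

module FormInCoordinates (t : CartanType) (n : ℕ) where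

  open CorootAction t {n}
  open InvariantForm t {n}

  row : (ℕ → ℤ) → ℕ → ℤ
  row x ℓ = ∑ℕ n (λ ℓ′ → x ℓ′ * cartan t ℓ′ ℓ)

  module _ {x : ℕ → ℤ} (x-vanishes : VanishesFrom n x) where

    private
      peel : ∀ f s p → ∑ℕ n (λ ℓ′ → f ℓ′ + s * (x ℓ′ * δ ℓ′ p)) ≡ ∑ℕ n f + s * x p
      peel f s p = ∑ℕ-peel n f s x p x-vanishes

      ∑ℕ-zero : ∑ℕ n (λ _ → + 0) ≡ + 0
      ∑ℕ-zero = sum-replicate-zero n

      peel₀ : ∀ s p → ∑ℕ n (λ ℓ′ → + 0 + s * (x ℓ′ * δ ℓ′ p)) ≡ + 0 + s * x p
      peel₀ s p = trans (peel (λ _ → + 0) s p) (cong (_+ s * x p) ∑ℕ-zero)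

    row-chain : ∀ ℓ → ∑ℕ n (λ ℓ′ → x ℓ′ * chainCartan ℓ′ ℓ) ≡ chainRow x ℓ
    row-chain ℓ = begin
      ∑ℕ n (λ ℓ′ → x ℓ′ * chainCartan ℓ′ ℓ)
        ≡⟨ ∑ℕ-cong n (λ ℓ′ _ → expand (x ℓ′) (δ ℓ′ ℓ) (δ ℓ′ (suc ℓ)) (δ (suc ℓ′) ℓ)) ⟩
      ∑ℕ n (λ ℓ′ → diagonal ℓ′ + - (+ 1) * (x ℓ′ * δ ℓ′ (suc ℓ)) + - (+ 1) * (x ℓ′ * δ (suc ℓ′) ℓ))
        ≡⟨ ∑ℕ-linear n (λ ℓ′ → diagonal ℓ′ + - (+ 1) * (x ℓ′ * δ ℓ′ (suc ℓ))) (- (+ 1)) (λ ℓ′ → x ℓ′ * δ (suc ℓ′) ℓ) ⟩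
      ∑ℕ n (λ ℓ′ → diagonal ℓ′ + - (+ 1) * (x ℓ′ * δ ℓ′ (suc ℓ))) + - (+ 1) * ∑ℕ n (λ ℓ′ → x ℓ′ * δ (suc ℓ′) ℓ)
        ≡⟨ cong₂ (λ a b → a + - (+ 1) * b) (peel diagonal (- (+ 1)) (suc ℓ)) (∑ℕ-δ-suc n x ℓ x-vanishes) ⟩
      ∑ℕ n diagonal + - (+ 1) * x (suc ℓ) + - (+ 1) * prev x ℓ
        ≡⟨ cong (λ a → a + - (+ 1) * x (suc ℓ) + - (+ 1) * prev x ℓ) (peel₀ (+ 2) ℓ) ⟩
      + 0 + + 2 * x ℓ + - (+ 1) * x (suc ℓ) + - (+ 1) * prev x ℓ
        ≡⟨ collect (x ℓ) (x (suc ℓ)) (prev x ℓ) ⟩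
      chainRow x ℓ ∎
      where
      open ≡-Reasoning
      diagonal : ℕ → ℤ
      diagonal ℓ′ = + 0 + + 2 * (x ℓ′ * δ ℓ′ ℓ)
      expand : ∀ a d₀ d₁ d₂ → a * (+ 2 * d₀ - d₁ - d₂) ≡ (+ 0 + + 2 * (a * d₀) + - (+ 1) * (a * d₁)) + - (+ 1) * (a * d₂)
      expand = solve-∀
      collect : ∀ a b p → + 0 + + 2 * a + - (+ 1) * b + - (+ 1) * p ≡ + 2 * a - b - p
      collect = solve-∀

    row-correction : ∀ t′ ℓ → ∑ℕ n (λ ℓ′ → x ℓ′ * cartanCorrection t′ ℓ′ ℓ) ≡ correctionRow t′ x ℓ
    row-correction A ℓ = trans (∑ℕ-cong n (λ ℓ′ _ → ℤ.*-zeroʳ (x ℓ′))) ∑ℕ-zero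
    row-correction B ℓ =
      trans (∑ℕ-cong n (λ ℓ′ _ → expand (x ℓ′) (δ ℓ′ 0) (δ ℓ 1))) (trans (peel₀ (- δ ℓ 1) 0) (collect (x 0) (δ ℓ 1)))
      where
      expand : ∀ a d d′ → a * - (d * d′) ≡ + 0 + (- d′) * (a * d)
      expand = solve-∀
      collect : ∀ a d′ → + 0 + (- d′) * a ≡ - (a * d′)
      collect = solve-∀
    row-correction C ℓ =
      trans (∑ℕ-cong n (λ ℓ′ _ → expand (x ℓ′) (δ ℓ′ 1) (δ ℓ 0))) (trans (peel₀ (- δ ℓ 0) 1) (collect (x 1) (δ ℓ 0)))
      where
      expand : ∀ a d d′ → a * - (d * d′) ≡ + 0 + (- d′) * (a * d)
      expand = solve-∀
      collect : ∀ a d′ → + 0 + (- d′) * a ≡ - (a * d′)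
      collect = solve-∀
    row-correction D ℓ = begin
      ∑ℕ n (λ ℓ′ → x ℓ′ * cartanCorrection D ℓ′ ℓ)
        ≡⟨ ∑ℕ-cong n (λ ℓ′ _ → expand (x ℓ′) (δ ℓ′ 0) (δ ℓ′ 1) (δ ℓ′ 2) (δ ℓ 0) (δ ℓ 1) (δ ℓ 2)) ⟩
      ∑ℕ n (λ ℓ′ → t₃ ℓ′ + (- δ ℓ 0) * (x ℓ′ * δ ℓ′ 2))
        ≡⟨ peel t₃ (- δ ℓ 0) 2 ⟩
      ∑ℕ n t₃ + (- δ ℓ 0) * x 2
        ≡⟨ cong (_+ (- δ ℓ 0) * x 2) (peel t₂ (- δ ℓ 2) 0) ⟩
      ∑ℕ n t₂ + (- δ ℓ 2) * x 0 + (- δ ℓ 0) * x 2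
        ≡⟨ cong (λ a → a + (- δ ℓ 2) * x 0 + (- δ ℓ 0) * x 2) (peel t₁ (δ ℓ 0) 1) ⟩
      ∑ℕ n t₁ + δ ℓ 0 * x 1 + (- δ ℓ 2) * x 0 + (- δ ℓ 0) * x 2
        ≡⟨ cong (λ a → a + δ ℓ 0 * x 1 + (- δ ℓ 2) * x 0 + (- δ ℓ 0) * x 2) (peel₀ (δ ℓ 1) 0) ⟩
      + 0 + δ ℓ 1 * x 0 + δ ℓ 0 * x 1 + (- δ ℓ 2) * x 0 + (- δ ℓ 0) * x 2
        ≡⟨ collect (x 0) (x 1) (x 2) (δ ℓ 0) (δ ℓ 1) (δ ℓ 2) ⟩
      correctionRow D x ℓ ∎
      where
      open ≡-Reasoning
      t₁ t₂ t₃ : ℕ → ℤ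
      t₁ ℓ′ = + 0 + δ ℓ 1 * (x ℓ′ * δ ℓ′ 0)
      t₂ ℓ′ = t₁ ℓ′ + δ ℓ 0 * (x ℓ′ * δ ℓ′ 1)
      t₃ ℓ′ = t₂ ℓ′ + (- δ ℓ 2) * (x ℓ′ * δ ℓ′ 0)
      expand : ∀ a i₀ i₁ i₂ j₀ j₁ j₂ → a * (i₀ * j₁ + i₁ * j₀ - i₀ * j₂ - i₂ * j₀)
             ≡ + 0 + j₁ * (a * i₀) + j₀ * (a * i₁) + (- j₂) * (a * i₀) + (- j₀) * (a * i₂)
      expand = solve-∀
      collect : ∀ x₀ x₁ x₂ j₀ j₁ j₂ → + 0 + j₁ * x₀ + j₀ * x₁ + (- j₂) * x₀ + (- j₀) * x₂
              ≡ x₀ * j₁ + x₁ * j₀ - x₀ * j₂ - x₂ * j₀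
      collect = solve-∀

    row-closed : ∀ ℓ → row x ℓ ≡ chainRow x ℓ + correctionRow t x ℓ
    row-closed ℓ = begin
      row x ℓ
        ≡⟨ ∑ℕ-cong n (λ ℓ′ _ → trans (cong (x ℓ′ *_) (cartan-chain+correction t ℓ′ ℓ))
                                      (ℤ.*-distribˡ-+ (x ℓ′) (chainCartan ℓ′ ℓ) (cartanCorrection t ℓ′ ℓ))) ⟩
      ∑ℕ n (λ ℓ′ → x ℓ′ * chainCartan ℓ′ ℓ + x ℓ′ * cartanCorrection t ℓ′ ℓ)
        ≡⟨ ∑-distrib-+ {n} (λ k → x (toℕ k) * chainCartan (toℕ k) ℓ) (λ k → x (toℕ k) * cartanCorrection t (toℕ k) ℓ) ⟩
      ∑ℕ n (λ ℓ′ → x ℓ′ * chainCartan ℓ′ ℓ) + ∑ℕ n (λ ℓ′ → x ℓ′ * cartanCorrection t ℓ′ ℓ)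
        ≡⟨ cong₂ _+_ (row-chain ℓ) (row-correction t ℓ) ⟩
      chainRow x ℓ + correctionRow t x ℓ ∎
      where open ≡-Reasoning

  closedForm : (ℕ → ℤ) → ℤ
  closedForm x = ∑ℕ n (λ ℓ → symmetrizer t ℓ * x ℓ * (chainRow x ℓ + correctionRow t x ℓ))

  form-closed : ∀ d → form d d ≡ closedForm (zeroExtend d)
  form-closed d = begin
    ∑[ k < n ] (ε k * d k * ⟨α k , d ⟩)
      ≡⟨ sum-cong-≗ (λ k → cong₂ (λ a b → ε k * a * b) (sym (zeroExtend-toℕ d k)) (⟨α⟩≡row k)) ⟩
    ∑ℕ n (λ ℓ → symmetrizer t ℓ * x ℓ * row x ℓ)
      ≡⟨ ∑ℕ-cong n (λ ℓ _ → cong (symmetrizer t ℓ * x ℓ *_) (row-closed (zeroExtend-vanishes d) ℓ)) ⟩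
    closedForm x ∎
    where
    open ≡-Reasoning
    x = zeroExtend d
    ⟨α⟩≡row : ∀ k → ⟨α k , d ⟩ ≡ row x (toℕ k)
    ⟨α⟩≡row k = sum-cong-≗ (λ m → cong (_* pair t m k) (sym (zeroExtend-toℕ d m)))

  ClosedFormDefinite : Set
  ClosedFormDefinite = ∀ x → VanishesFrom n x → closedForm x ℤ.≤ + 0 → ∀ ℓ → ℓ < n → x ℓ ≡ + 0

  closedFormDefinite⇒positiveDefinite : ClosedFormDefinite → PositiveDefinite
  closedFormDefinite⇒positiveDefinite zero-if≤0 d form≤0 k =
    trans (sym (zeroExtend-toℕ d k))
          (zero-if≤0 (zeroExtend d) (zeroExtend-vanishes d) (subst (ℤ._≤ + 0) (form-closed d) form≤0) (toℕ k) (Fin.toℕ<n k))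

-- Positive definiteness: the form as a sum of squares

∑ℕ-peel-* : ∀ {N x} → VanishesFrom N x → ∀ f s (g : ℕ → ℤ) p →
  ∑ℕ N (λ ℓ → f ℓ + s * (x ℓ * g ℓ * δ ℓ p)) ≡ ∑ℕ N f + s * (x p * g p)
∑ℕ-peel-* {N} {x} x-vanishes f s g p = ∑ℕ-peel N f s (λ ℓ → x ℓ * g ℓ) p (vanishesFrom-* g x-vanishes)

closedForm-A : ∀ {n x} → VanishesFrom n x → FormInCoordinates.closedForm A n x ≡ x 0 * x 0 + ∑Δ² n x
closedForm-A {n} {x} x-vanishes =
  trans (∑ℕ-cong n (λ ℓ _ → simplify (x ℓ) (chainRow x ℓ))) (∑ℕ-chain-vanishing n x (x-vanishes n ℕ.≤-refl))
  where simplify : ∀ a c → + 1 * a * (c + + 0) ≡ a * c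
        simplify = solve-∀

symmetrizer-B : ∀ ℓ → symmetrizer B ℓ ≡ + 1 + δ ℓ 0
symmetrizer-B zero    = refl
symmetrizer-B (suc ℓ) = refl

closedForm-B : ∀ m {x} → VanishesFrom (suc (suc m)) x →
  FormInCoordinates.closedForm B (suc (suc m)) x ≡ (+ 2 * x 0 - x 1) * (+ 2 * x 0 - x 1) + ∑Δ² (suc m) (x ∘ suc)
closedForm-B m {x} x-vanishes = begin
  ∑ℕ n (λ ℓ → symmetrizer B ℓ * x ℓ * (chainRow x ℓ + correctionRow B x ℓ))
    ≡⟨ ∑ℕ-cong n (λ ℓ _ → trans (cong (λ e → e * x ℓ * (chainRow x ℓ + correctionRow B x ℓ)) (symmetrizer-B ℓ))
                               (expand (x ℓ) (chainRow x ℓ) (x 0) (δ ℓ 0) (δ ℓ 1))) ⟩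
  ∑ℕ n (λ ℓ → t₂ ℓ + (- x 0) * (x ℓ * δ ℓ 1 * δ ℓ 0))
    ≡⟨ ∑ℕ-peel-* x-vanishes t₂ (- x 0) (λ ℓ → δ ℓ 1) 0 ⟩
  ∑ℕ n t₂ + (- x 0) * (x 0 * + 0)
    ≡⟨ cong (_+ (- x 0) * (x 0 * + 0)) (∑ℕ-peel-* x-vanishes t₁ (- x 0) (λ _ → + 1) 1) ⟩
  ∑ℕ n t₁ + (- x 0) * (x 1 * + 1) + (- x 0) * (x 0 * + 0)
    ≡⟨ cong (λ a → a + (- x 0) * (x 1 * + 1) + (- x 0) * (x 0 * + 0))
            (∑ℕ-peel-* x-vanishes (λ ℓ → x ℓ * chainRow x ℓ) (+ 1) (chainRow x) 0) ⟩
  ∑ℕ n (λ ℓ → x ℓ * chainRow x ℓ) + + 1 * (x 0 * chainRow x 0) + (- x 0) * (x 1 * + 1) + (- x 0) * (x 0 * + 0)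
    ≡⟨ cong (λ a → a + + 1 * (x 0 * chainRow x 0) + (- x 0) * (x 1 * + 1) + (- x 0) * (x 0 * + 0))
            (∑ℕ-chain-vanishing n x (x-vanishes n ℕ.≤-refl)) ⟩
  x 0 * x 0 + ((x 0 - x 1) * (x 0 - x 1) + R) + + 1 * (x 0 * (+ 2 * x 0 - x 1 - + 0)) + (- x 0) * (x 1 * + 1) + (- x 0) * (x 0 * + 0)
    ≡⟨ collect (x 0) (x 1) R ⟩
  (+ 2 * x 0 - x 1) * (+ 2 * x 0 - x 1) + R ∎
  where
  open ≡-Reasoning
  n = suc (suc m)
  R = ∑Δ² (suc m) (x ∘ suc)
  t₁ t₂ : ℕ → ℤ
  t₁ ℓ = x ℓ * chainRow x ℓ + + 1 * (x ℓ * chainRow x ℓ * δ ℓ 0)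
  t₂ ℓ = t₁ ℓ + (- x 0) * (x ℓ * + 1 * δ ℓ 1)
  expand : ∀ a c x₀ d₀ d₁ → (+ 1 + d₀) * a * (c + - (x₀ * d₁))
         ≡ a * c + + 1 * (a * c * d₀) + (- x₀) * (a * + 1 * d₁) + (- x₀) * (a * d₁ * d₀)
  expand = solve-∀
  collect : ∀ x₀ x₁ R → x₀ * x₀ + ((x₀ - x₁) * (x₀ - x₁) + R) + + 1 * (x₀ * (+ 2 * x₀ - x₁ - + 0))
                        + (- x₀) * (x₁ * + 1) + (- x₀) * (x₀ * + 0)
                      ≡ (+ 2 * x₀ - x₁) * (+ 2 * x₀ - x₁) + R
  collect = solve-∀

symmetrizer-C : ∀ ℓ → symmetrizer C ℓ ≡ + 2 - δ ℓ 0
symmetrizer-C zero    = refl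
symmetrizer-C (suc ℓ) = refl

closedForm-C : ∀ m {x} → VanishesFrom (suc (suc m)) x →
  FormInCoordinates.closedForm C (suc (suc m)) x ≡ + 2 * ((x 0 - x 1) * (x 0 - x 1) + ∑Δ² (suc m) (x ∘ suc))
closedForm-C m {x} x-vanishes = begin
  ∑ℕ n (λ ℓ → symmetrizer C ℓ * x ℓ * (chainRow x ℓ + correctionRow C x ℓ))
    ≡⟨ ∑ℕ-cong n (λ ℓ _ → trans (cong (λ e → e * x ℓ * (chainRow x ℓ + correctionRow C x ℓ)) (symmetrizer-C ℓ))
                               (expand (x ℓ) (chainRow x ℓ) (x 1) (δ ℓ 0))) ⟩
  ∑ℕ n (λ ℓ → t₃ ℓ + x 1 * (x ℓ * δ ℓ 0 * δ ℓ 0))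
    ≡⟨ ∑ℕ-peel-* x-vanishes t₃ (x 1) (λ ℓ → δ ℓ 0) 0 ⟩
  ∑ℕ n t₃ + x 1 * (x 0 * + 1)
    ≡⟨ cong (_+ x 1 * (x 0 * + 1)) (∑ℕ-peel-* x-vanishes t₂ (- (+ 2 * x 1)) (λ _ → + 1) 0) ⟩
  ∑ℕ n t₂ + - (+ 2 * x 1) * (x 0 * + 1) + x 1 * (x 0 * + 1)
    ≡⟨ cong (λ a → a + - (+ 2 * x 1) * (x 0 * + 1) + x 1 * (x 0 * + 1)) (∑ℕ-peel-* x-vanishes t₁ (- (+ 1)) (chainRow x) 0) ⟩
  ∑ℕ n t₁ + - (+ 1) * (x 0 * chainRow x 0) + - (+ 2 * x 1) * (x 0 * + 1) + x 1 * (x 0 * + 1)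
    ≡⟨ cong (λ a → a + - (+ 1) * (x 0 * chainRow x 0) + - (+ 2 * x 1) * (x 0 * + 1) + x 1 * (x 0 * + 1)) twice-chain ⟩
  + 0 + + 2 * (x 0 * x 0 + ((x 0 - x 1) * (x 0 - x 1) + R)) + - (+ 1) * (x 0 * (+ 2 * x 0 - x 1 - + 0))
    + - (+ 2 * x 1) * (x 0 * + 1) + x 1 * (x 0 * + 1)
    ≡⟨ collect (x 0) (x 1) R ⟩
  + 2 * ((x 0 - x 1) * (x 0 - x 1) + R) ∎
  where
  open ≡-Reasoning
  n = suc (suc m)
  R = ∑Δ² (suc m) (x ∘ suc)
  t₁ t₂ t₃ : ℕ → ℤ
  t₁ ℓ = + 0 + + 2 * (x ℓ * chainRow x ℓ)
  t₂ ℓ = t₁ ℓ + - (+ 1) * (x ℓ * chainRow x ℓ * δ ℓ 0)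
  t₃ ℓ = t₂ ℓ + - (+ 2 * x 1) * (x ℓ * + 1 * δ ℓ 0)
  twice-chain : ∑ℕ n t₁ ≡ + 0 + + 2 * (x 0 * x 0 + ∑Δ² n x)
  twice-chain = trans (∑ℕ-linear n (λ _ → + 0) (+ 2) (λ ℓ → x ℓ * chainRow x ℓ))
                      (cong₂ (λ a b → a + + 2 * b) (sum-replicate-zero n) (∑ℕ-chain-vanishing n x (x-vanishes n ℕ.≤-refl)))
  expand : ∀ a c x₁ d₀ → (+ 2 - d₀) * a * (c + - (x₁ * d₀))
         ≡ + 0 + + 2 * (a * c) + - (+ 1) * (a * c * d₀) + - (+ 2 * x₁) * (a * + 1 * d₀) + x₁ * (a * d₀ * d₀)
  expand = solve-∀
  collect : ∀ x₀ x₁ R → + 0 + + 2 * (x₀ * x₀ + ((x₀ - x₁) * (x₀ - x₁) + R)) + - (+ 1) * (x₀ * (+ 2 * x₀ - x₁ - + 0))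
                        + - (+ 2 * x₁) * (x₀ * + 1) + x₁ * (x₀ * + 1)
                      ≡ + 2 * ((x₀ - x₁) * (x₀ - x₁) + R)
  collect = solve-∀

closedForm-D : ∀ m {x} → VanishesFrom (suc (suc (suc (suc m)))) x →
  FormInCoordinates.closedForm D (suc (suc (suc (suc m)))) x
    ≡ (x 0 + x 1 - x 2) * (x 0 + x 1 - x 2) + ((x 0 - x 1) * (x 0 - x 1) + ∑Δ² (suc (suc m)) (λ ℓ → x (suc (suc ℓ))))
closedForm-D m {x} x-vanishes = begin
  ∑ℕ n (λ ℓ → + 1 * x ℓ * (chainRow x ℓ + correctionRow D x ℓ))
    ≡⟨ ∑ℕ-cong n (λ ℓ _ → expand (x ℓ) (chainRow x ℓ) (x 0) (x 1) (x 2) (δ ℓ 0) (δ ℓ 1) (δ ℓ 2)) ⟩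
  ∑ℕ n (λ ℓ → t₃ ℓ + (- x 2) * (x ℓ * + 1 * δ ℓ 0))
    ≡⟨ ∑ℕ-peel-* x-vanishes t₃ (- x 2) (λ _ → + 1) 0 ⟩
  ∑ℕ n t₃ + (- x 2) * (x 0 * + 1)
    ≡⟨ cong (_+ (- x 2) * (x 0 * + 1)) (∑ℕ-peel-* x-vanishes t₂ (- x 0) (λ _ → + 1) 2) ⟩
  ∑ℕ n t₂ + (- x 0) * (x 2 * + 1) + (- x 2) * (x 0 * + 1)
    ≡⟨ cong (λ a → a + (- x 0) * (x 2 * + 1) + (- x 2) * (x 0 * + 1)) (∑ℕ-peel-* x-vanishes t₁ (x 1) (λ _ → + 1) 0) ⟩
  ∑ℕ n t₁ + x 1 * (x 0 * + 1) + (- x 0) * (x 2 * + 1) + (- x 2) * (x 0 * + 1)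
    ≡⟨ cong (λ a → a + x 1 * (x 0 * + 1) + (- x 0) * (x 2 * + 1) + (- x 2) * (x 0 * + 1))
            (∑ℕ-peel-* x-vanishes (λ ℓ → x ℓ * chainRow x ℓ) (x 0) (λ _ → + 1) 1) ⟩
  ∑ℕ n (λ ℓ → x ℓ * chainRow x ℓ) + x 0 * (x 1 * + 1) + x 1 * (x 0 * + 1) + (- x 0) * (x 2 * + 1) + (- x 2) * (x 0 * + 1)
    ≡⟨ cong (λ a → a + x 0 * (x 1 * + 1) + x 1 * (x 0 * + 1) + (- x 0) * (x 2 * + 1) + (- x 2) * (x 0 * + 1))
            (∑ℕ-chain-vanishing n x (x-vanishes n ℕ.≤-refl)) ⟩
  x 0 * x 0 + ((x 0 - x 1) * (x 0 - x 1) + ((x 1 - x 2) * (x 1 - x 2) + R))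
    + x 0 * (x 1 * + 1) + x 1 * (x 0 * + 1) + (- x 0) * (x 2 * + 1) + (- x 2) * (x 0 * + 1)
    ≡⟨ collect (x 0) (x 1) (x 2) R ⟩
  (x 0 + x 1 - x 2) * (x 0 + x 1 - x 2) + ((x 0 - x 1) * (x 0 - x 1) + R) ∎
  where
  open ≡-Reasoning
  n = suc (suc (suc (suc m)))
  R = ∑Δ² (suc (suc m)) (λ ℓ → x (suc (suc ℓ)))
  t₁ t₂ t₃ : ℕ → ℤ
  t₁ ℓ = x ℓ * chainRow x ℓ + x 0 * (x ℓ * + 1 * δ ℓ 1)
  t₂ ℓ = t₁ ℓ + x 1 * (x ℓ * + 1 * δ ℓ 0)
  t₃ ℓ = t₂ ℓ + (- x 0) * (x ℓ * + 1 * δ ℓ 2)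
  expand : ∀ a c x₀ x₁ x₂ d₀ d₁ d₂ → + 1 * a * (c + (x₀ * d₁ + x₁ * d₀ - x₀ * d₂ - x₂ * d₀))
         ≡ a * c + x₀ * (a * + 1 * d₁) + x₁ * (a * + 1 * d₀) + (- x₀) * (a * + 1 * d₂) + (- x₂) * (a * + 1 * d₀)
  expand = solve-∀
  collect : ∀ x₀ x₁ x₂ R → x₀ * x₀ + ((x₀ - x₁) * (x₀ - x₁) + ((x₁ - x₂) * (x₁ - x₂) + R))
                           + x₀ * (x₁ * + 1) + x₁ * (x₀ * + 1) + (- x₀) * (x₂ * + 1) + (- x₂) * (x₀ * + 1)
                         ≡ (x₀ + x₁ - x₂) * (x₀ + x₁ - x₂) + ((x₀ - x₁) * (x₀ - x₁) + R)
  collect = solve-∀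

closedFormDefinite-A : ∀ n → FormInCoordinates.ClosedFormDefinite A n
closedFormDefinite-A n x x-vanishes Q≤0 ℓ ℓ<n =
  ∑Δ²≤0 n x (proj₂ (nonneg-+≤0 {x 0 * x 0} (square-nonneg (x 0)) (∑Δ²-nonneg n x)
                               (subst (ℤ._≤ + 0) (closedForm-A x-vanishes) Q≤0)))
        (x-vanishes n ℕ.≤-refl) ℓ (ℕ.<⇒≤ ℓ<n)

closedFormDefinite-B : ∀ m → FormInCoordinates.ClosedFormDefinite B (suc (suc m))
closedFormDefinite-B m x x-vanishes Q≤0 = vanishes
  where
  y = + 2 * x 0 - x 1
  squares≤0 = nonneg-+≤0 {y * y} (square-nonneg y) (∑Δ²-nonneg (suc m) (x ∘ suc))
                         (subst (ℤ._≤ + 0) (closedForm-B m x-vanishes) Q≤0)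
  tail≡0 : ∀ ℓ → ℓ ℕ.≤ suc m → x (suc ℓ) ≡ + 0
  tail≡0 = ∑Δ²≤0 (suc m) (x ∘ suc) (proj₂ squares≤0) (x-vanishes (suc (suc m)) ℕ.≤-refl)
  split : ∀ a b → a + a ≡ (+ 2 * a - b) + b
  split = solve-∀
  vanishes : ∀ ℓ → ℓ < suc (suc m) → x ℓ ≡ + 0
  vanishes zero    _         =
    a+a≡0⇒a≡0 (x 0) (trans (split (x 0) (x 1)) (cong₂ _+_ (square≤0⇒≡0 y (proj₁ squares≤0)) (tail≡0 0 z≤n)))
  vanishes (suc ℓ) (s≤s ℓ<n) = tail≡0 ℓ (ℕ.<⇒≤ ℓ<n)

closedFormDefinite-C : ∀ m → FormInCoordinates.ClosedFormDefinite C (suc (suc m))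
closedFormDefinite-C m x x-vanishes Q≤0 = vanishes
  where
  y = x 0 - x 1
  half≤0 : y * y + ∑Δ² (suc m) (x ∘ suc) ℤ.≤ + 0
  half≤0 = ℤ.*-cancelˡ-≤-pos _ (+ 0) (+ 2) (subst (ℤ._≤ + 0) (closedForm-C m x-vanishes) Q≤0)
  squares≤0 = nonneg-+≤0 {y * y} (square-nonneg y) (∑Δ²-nonneg (suc m) (x ∘ suc)) half≤0
  tail≡0 : ∀ ℓ → ℓ ℕ.≤ suc m → x (suc ℓ) ≡ + 0
  tail≡0 = ∑Δ²≤0 (suc m) (x ∘ suc) (proj₂ squares≤0) (x-vanishes (suc (suc m)) ℕ.≤-refl)
  split : ∀ a b → a ≡ (a - b) + b
  split = solve-∀
  vanishes : ∀ ℓ → ℓ < suc (suc m) → x ℓ ≡ + 0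
  vanishes zero    _         = trans (split (x 0) (x 1)) (cong₂ _+_ (square≤0⇒≡0 y (proj₁ squares≤0)) (tail≡0 0 z≤n))
  vanishes (suc ℓ) (s≤s ℓ<n) = tail≡0 ℓ (ℕ.<⇒≤ ℓ<n)

closedFormDefinite-D : ∀ m → FormInCoordinates.ClosedFormDefinite D (suc (suc (suc (suc m))))
closedFormDefinite-D m x x-vanishes Q≤0 = vanishes
  where
  y = x 0 + x 1 - x 2
  z = x 0 - x 1
  squares≤0 = nonneg-+≤0 {y * y} (square-nonneg y)
                         (ℤ.+-mono-≤ (square-nonneg z) (∑Δ²-nonneg (suc (suc m)) (λ ℓ → x (suc (suc ℓ)))))
                         (subst (ℤ._≤ + 0) (closedForm-D m x-vanishes) Q≤0)
  rest≤0 = nonneg-+≤0 {z * z} (square-nonneg z) (∑Δ²-nonneg (suc (suc m)) (λ ℓ → x (suc (suc ℓ)))) (proj₂ squares≤0)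
  y≡0 : y ≡ + 0
  y≡0 = square≤0⇒≡0 y (proj₁ squares≤0)
  z≡0 : z ≡ + 0
  z≡0 = square≤0⇒≡0 z (proj₁ rest≤0)
  tail≡0 : ∀ ℓ → ℓ ℕ.≤ suc (suc m) → x (suc (suc ℓ)) ≡ + 0
  tail≡0 = ∑Δ²≤0 (suc (suc m)) (λ ℓ → x (suc (suc ℓ))) (proj₂ rest≤0) (x-vanishes (suc (suc (suc (suc m)))) ℕ.≤-refl)
  split₀ : ∀ a b c → a + a ≡ (a + b - c) + (a - b) + c
  split₀ = solve-∀
  split₁ : ∀ a b → b ≡ a - (a - b)
  split₁ = solve-∀
  x₀≡0 : x 0 ≡ + 0
  x₀≡0 = a+a≡0⇒a≡0 (x 0) (trans (split₀ (x 0) (x 1) (x 2)) (trans (cong₂ (λ a b → a + b + x 2) y≡0 z≡0)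
                                                                  (trans (ℤ.+-identityˡ (x 2)) (tail≡0 0 z≤n))))
  vanishes : ∀ ℓ → ℓ < suc (suc (suc (suc m))) → x ℓ ≡ + 0
  vanishes zero          _               = x₀≡0
  vanishes (suc zero)    _               = trans (split₁ (x 0) (x 1)) (cong₂ _-_ x₀≡0 z≡0)
  vanishes (suc (suc ℓ)) (s≤s (s≤s ℓ<n)) = tail≡0 ℓ (ℕ.<⇒≤ ℓ<n)

positiveDefinite : ∀ t n → ValidRank t n → InvariantForm.PositiveDefinite t {n}
positiveDefinite t n valid = FormInCoordinates.closedFormDefinite⇒positiveDefinite t n (definite t n valid)
  where
  definite : ∀ t n → ValidRank t n → FormInCoordinates.ClosedFormDefinite t n
  definite A n                            _ = closedFormDefinite-A n
  definite B (suc (suc m))                _ = closedFormDefinite-B m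
  definite C (suc (suc m))                _ = closedFormDefinite-C m
  definite D (suc (suc (suc (suc m))))    _ = closedFormDefinite-D m
  definite B (suc zero)                   (s≤s ())
  definite C (suc zero)                   (s≤s ())
  definite D (suc zero)                   (s≤s ())
  definite D (suc (suc zero))             (s≤s (s≤s ()))
  definite D (suc (suc (suc zero)))       (s≤s (s≤s (s≤s ())))

-- Inversion coroots of reduced words

reverse-split : ∀ {A : Set} (pre : List A) a suf → reverse (pre ++ a ∷ suf) ≡ reverse suf ++ a ∷ reverse pre
reverse-split pre a suf = begin
  reverse (pre ++ a ∷ suf)               ≡⟨ List.reverse-++ pre (a ∷ suf) ⟩
  reverse (a ∷ suf) ++ reverse pre       ≡⟨ cong (_++ reverse pre) (List.unfold-reverse a suf) ⟩
  (reverse suf ++ a ∷ []) ++ reverse pre ≡⟨ List.++-assoc (reverse suf) (a ∷ []) (reverse pre) ⟩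
  reverse suf ++ a ∷ reverse pre         ∎
  where open ≡-Reasoning

MinWord-at : ∀ {t n} (pre : Word n) m suf {Λ} → MinWord t (pre ++ m ∷ suf) Λ → act t suf Λ m ≡ + 1
MinWord-at []        m suf (step , _) = step
MinWord-at (_ ∷ pre) m suf (_ , rest) = MinWord-at pre m suf rest

MinWord-suffix : ∀ {t n} (pre : Word n) m suf {Λ} → MinWord t (pre ++ m ∷ suf) Λ → MinWord t suf Λ
MinWord-suffix []        m suf (_ , rest) = rest
MinWord-suffix (_ ∷ pre) m suf (_ , rest) = MinWord-suffix pre m suf rest

MinWord-from-letters : ∀ {t n} (v : Word n) {Λ} → (∀ pre a suf → v ≡ pre ++ a ∷ suf → act t suf Λ a ≡ + 1) → MinWord t v Λ
MinWord-from-letters []      _      = tt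
MinWord-from-letters (a ∷ v) letter =
  letter [] a v refl , MinWord-from-letters v (λ pre b suf v≡ → letter (a ∷ pre) b suf (cong (a ∷_) v≡))

module Reduced (t : CartanType) {n : ℕ} where

  open CorootAction t {n}
  open InvariantForm t {n}

  ⟨α⟩-transport : ∀ z a m → actᵀ z (fund a) ≗ fund m → ∀ c → ⟨α m , actᵀ z c ⟩ ≡ ⟨α a , c ⟩
  ⟨α⟩-transport z a m z∙αa≡αm c =
    sym (ℤ.*-cancelˡ-≡ (ε a) ⟨α a , c ⟩ ⟨α m , actᵀ z c ⟩ {{ℤ.>-nonZero (symmetrizer-pos t (toℕ a))}} (begin
    ε a * ⟨α a , c ⟩                        ≡⟨ form-fundˡ a c ⟨
    form (fund a) c                         ≡⟨ form-actᵀ z (fund a) c ⟨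
    form (actᵀ z (fund a)) (actᵀ z c)       ≡⟨ form-congˡ (actᵀ z c) z∙αa≡αm ⟩
    form (fund m) (actᵀ z c)                ≡⟨ form-fundˡ m (actᵀ z c) ⟩
    ε m * ⟨α m , actᵀ z c ⟩                 ≡⟨ cong (_* ⟨α m , actᵀ z c ⟩) εm≡εa ⟩
    ε a * ⟨α m , actᵀ z c ⟩                 ∎))
    where
    open ≡-Reasoning
    εm≡εa : ε m ≡ ε a
    εm≡εa = ℤ.*-cancelʳ-≡ (ε m) (ε a) (+ 2) (begin
      ε m * + 2                                   ≡⟨ form-fund-diag m ⟨
      form (fund m) (fund m)                      ≡⟨ form-cong z∙αa≡αm z∙αa≡αm ⟨
      form (actᵀ z (fund a)) (actᵀ z (fund a))    ≡⟨ form-actᵀ z (fund a) (fund a) ⟩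
      form (fund a) (fund a)                      ≡⟨ form-fund-diag a ⟩
      ε a * + 2                                   ∎)

  conjugate-reflections : ∀ z a m → actᵀ z (fund a) ≗ fund m → ∀ c → actᵀ (a ∷ z ++ m ∷ []) c ≗ actᵀ z c
  conjugate-reflections z a m z∙αa≡αm c k = begin
    actᵀ (z ++ m ∷ []) (s∨ a c) k                        ≡⟨ cong (λ f → f k) (actᵀ-++ z (m ∷ []) (s∨ a c)) ⟩
    s∨ m (actᵀ z (s∨ a c)) k                             ≡⟨ s∨-cong m z∙s∨c k ⟩
    s∨ m (λ k → y k + (- L) * fund m k) k                ≡⟨ cong (λ a → y k + (- L) * fund m k - a * fund m k) ⟨α⟩-z∙s∨c ⟩
    y k + (- L) * fund m k - (L + (- L) * + 2) * fund m k ≡⟨ cancel (y k) L (fund m k) ⟩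
    y k                                                  ∎
    where
    open ≡-Reasoning
    y = actᵀ z c
    L = ⟨α a , c ⟩
    z∙s∨c : actᵀ z (s∨ a c) ≗ (λ k → y k + (- L) * fund m k)
    z∙s∨c k = trans (actᵀ-cong z (s∨-as-linear a c) k)
                    (trans (actᵀ-linear z c (- L) (fund a) k) (cong (λ f → y k + (- L) * f) (z∙αa≡αm k)))
    ⟨α⟩-z∙s∨c : ⟨α m , (λ k → y k + (- L) * fund m k) ⟩ ≡ L + (- L) * + 2
    ⟨α⟩-z∙s∨c = trans (⟨α⟩-linear m y (- L) (fund m))
                      (cong₂ (λ u v → u + (- L) * v) (⟨α⟩-transport z a m z∙αa≡αm c) (⟨α⟩-fund-diag m))
    cancel : ∀ y x f → y + (- x) * f - (x + (- x) * + 2) * f ≡ y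
    cancel = solve-∀

  IsReduced : Word n → Set
  IsReduced v = ∀ y → (∀ c → actᵀ y c ≗ actᵀ v c) → length v ℕ.≤ length y

  isReduced-reverse : ∀ v → IsReduced v → IsReduced (reverse v)
  isReduced-reverse v v-reduced y y~v = subst₂ ℕ._≤_ (sym (List.length-reverse v)) (List.length-reverse y)
    (v-reduced (reverse y) (λ c k → trans (actᵀ-reverse-cong y (reverse v) y~v c k)
                                          (cong (λ z → actᵀ z c k) (List.reverse-involutive v))))

  cancellation-not-reduced : ∀ pre a z₁ m z₂ → actᵀ z₁ (fund a) ≗ fund m → ¬ IsReduced (pre ++ a ∷ z₁ ++ m ∷ z₂)
  cancellation-not-reduced pre a z₁ m z₂ z₁∙αa≡αm reduced =
    ℕ.<⇒≱ shorter (reduced (pre ++ z₁ ++ z₂) same)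
    where
    open ≡-Reasoning
    same : ∀ c → actᵀ (pre ++ z₁ ++ z₂) c ≗ actᵀ (pre ++ a ∷ z₁ ++ m ∷ z₂) c
    same c k = begin
      actᵀ (pre ++ z₁ ++ z₂) c k                        ≡⟨ cong (λ f → f k) (actᵀ-++ pre (z₁ ++ z₂) c) ⟩
      actᵀ (z₁ ++ z₂) c′ k                              ≡⟨ cong (λ f → f k) (actᵀ-++ z₁ z₂ c′) ⟩
      actᵀ z₂ (actᵀ z₁ c′) k                            ≡⟨ actᵀ-cong z₂ (conjugate-reflections z₁ a m z₁∙αa≡αm c′) k ⟨
      actᵀ z₂ (actᵀ (a ∷ z₁ ++ m ∷ []) c′) k            ≡⟨ cong (λ f → f k) (actᵀ-++ (a ∷ z₁ ++ m ∷ []) z₂ c′) ⟨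
      actᵀ ((a ∷ z₁ ++ m ∷ []) ++ z₂) c′ k              ≡⟨ cong (λ w → actᵀ (a ∷ w) c′ k) (List.++-assoc z₁ (m ∷ []) z₂) ⟩
      actᵀ (a ∷ z₁ ++ m ∷ z₂) c′ k                      ≡⟨ cong (λ f → f k) (actᵀ-++ pre (a ∷ z₁ ++ m ∷ z₂) c) ⟨
      actᵀ (pre ++ a ∷ z₁ ++ m ∷ z₂) c k                ∎
      where c′ = actᵀ pre c
    shorter : length (pre ++ z₁ ++ z₂) ℕ.< length (pre ++ a ∷ z₁ ++ m ∷ z₂)
    shorter rewrite List.length-++ pre {z₁ ++ z₂} | List.length-++ pre {a ∷ z₁ ++ m ∷ z₂}
                  | List.length-++ z₁ {z₂} | List.length-++ z₁ {m ∷ z₂} =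
      ℕ.+-monoʳ-< (length pre) (s≤s (ℕ.+-monoʳ-≤ (length z₁) (ℕ.n≤1+n (length z₂))))

  module _ (pd : PositiveDefinite) where

    -- For d = c - c_m α_m^∨ one finds form d d = 2 ε_j (1 - q (⟨α_m, c⟩ - c_m)) ≤ 0, where q ≥ 1
    -- because ε_m c_m = ε_j q; positive definiteness then gives d = 0.
    simple-coroot : ∀ {j c} m → form c c ≡ ε j * + 2 → DivisibleBy j c → Nonneg c → s∨ m c m ℤ.< + 0 →
                    + 0 ℤ.< c m × c ≗ (λ k → c m * fund m k)
    simple-coroot {j} {c} m form-c c-divisible c≥0 flips = 0<κ , c≡κα
      where
      κ = c m
      L = ⟨α m , c ⟩
      κ<L : κ ℤ.< L
      κ<L = i-j<0⇒i<j κ L (subst (λ a → κ - a ℤ.< + 0) (trans (cong (L *_) (fund-diag m)) (ℤ.*-identityʳ L)) flips)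
      0<κ : + 0 ℤ.< κ
      0<κ = positive-below-double (c≥0 m) κ<L (⟨α⟩≤2* c≥0 m)
      q = proj₁ (c-divisible m)
      εκ≡εq : ε m * κ ≡ ε j * q
      εκ≡εq = proj₂ (c-divisible m)
      1≤q : + 1 ℤ.≤ q
      1≤q = ℤ.i<j⇒suc[i]≤j (pos-*⇒pos q (symmetrizer-pos t (toℕ j))
              (subst (+ 0 ℤ.<_) εκ≡εq (pos-*-pos (symmetrizer-pos t (toℕ m)) 0<κ)))
      d : Q∨
      d k = c k + (- κ) * fund m k
      form-d : form d d ≡ (+ 2 * ε j) * (+ 1 - q * (L - κ))
      form-d = begin
        form d d                                                            ≡⟨ form-add-simple c (- κ) m ⟩
        form c c + + 2 * (- κ) * (ε m * L) + + 2 * ((- κ) * (- κ)) * ε m    ≡⟨ regroup (form c c) κ (ε m) L ⟩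
        form c c - + 2 * (ε m * κ) * (L - κ)                                ≡⟨ cong₂ (λ a b → a - + 2 * b * (L - κ)) form-c εκ≡εq ⟩
        ε j * + 2 - + 2 * (ε j * q) * (L - κ)                               ≡⟨ factor (ε j) q (L - κ) ⟩
        (+ 2 * ε j) * (+ 1 - q * (L - κ))                                   ∎
        where
        open ≡-Reasoning
        regroup : ∀ Q κ e L → Q + + 2 * (- κ) * (e * L) + + 2 * ((- κ) * (- κ)) * e ≡ Q - + 2 * (e * κ) * (L - κ)
        regroup = solve-∀
        factor : ∀ e q D → e * + 2 - + 2 * (e * q) * D ≡ (+ 2 * e) * (+ 1 - q * D)
        factor = solve-∀
      form-d≤0 : form d d ℤ.≤ + 0
      form-d≤0 = subst (ℤ._≤ + 0) (sym form-d)
        (nonneg-*-nonpos (ℤ.<⇒≤ (pos-*-pos {+ 2} (+<+ (s≤s z≤n)) (symmetrizer-pos t (toℕ j))))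
                         (ℤ.i≤j⇒i-j≤0 (1≤-*-1≤ 1≤q (i<j⇒1≤j-i κ<L))))
      c≡κα : c ≗ (λ k → κ * fund m k)
      c≡κα k = trans (shift (c k) κ (fund m k)) (trans (cong (_+ κ * fund m k) (pd d form-d≤0 k)) (ℤ.+-identityˡ _))
        where shift : ∀ a κ f → a ≡ (a + (- κ) * f) + κ * f
              shift = solve-∀

    record SimpleStep (z : Word n) (γ : Q∨) : Set where
      field
        before : Word n
        letter : Fin n
        after  : Word n
        split  : z ≡ before ++ letter ∷ after
        simple : actᵀ before γ ≗ fund letter

    -- At the first sign change the coroot is a positive multiple κ α_m^∨ by simple-coroot; it is
    -- a W-translate of α_a^∨, and reading the a-th coordinate of α_a^∨ gives κ = 1.
    becomes-simple : ∀ x a z → Nonneg (actᵀ x (fund a)) → (∃[ k ] actᵀ z (actᵀ x (fund a)) k ℤ.< + 0) →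
                     SimpleStep z (actᵀ x (fund a))
    becomes-simple x a z γ≥0 negative =
      record { before = before ; letter = letter ; after = after ; split = split ; simple = β≡α }
      where
      open FirstNegativeStep (first-negative-step z γ≥0 negative)
      w = x ++ before
      β = actᵀ before (actᵀ x (fund a))
      β≡w∙αa : β ≡ actᵀ w (fund a)
      β≡w∙αa = sym (actᵀ-++ x before (fund a))
      κ = β letter
      β≡κα : + 0 ℤ.< κ × β ≗ (λ k → κ * fund letter k)
      β≡κα = simple-coroot letter
        (trans (cong₂ form β≡w∙αa β≡w∙αa) (trans (form-actᵀ w (fund a) (fund a)) (form-fund-diag a)))
        (subst (DivisibleBy a) (sym β≡w∙αa) (divisible-actᵀ w (fund-divisible a)))
        nonneg flips
      αa≡κ∙ : ∀ k → fund a k ≡ κ * actᵀ (reverse w) (fund letter) k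
      αa≡κ∙ k = begin
        fund a k                                          ≡⟨ actᵀ-reverseˡ w (fund a) k ⟨
        actᵀ (reverse w) (actᵀ w (fund a)) k               ≡⟨ cong (λ c → actᵀ (reverse w) c k) β≡w∙αa ⟨
        actᵀ (reverse w) β k                              ≡⟨ actᵀ-cong (reverse w) (proj₂ β≡κα) k ⟩
        actᵀ (reverse w) (λ k → κ * fund letter k) k      ≡⟨ actᵀ-scale (reverse w) κ (fund letter) k ⟩
        κ * actᵀ (reverse w) (fund letter) k              ∎
        where open ≡-Reasoning
      κ≡1 : κ ≡ + 1
      κ≡1 = pos-*≡1⇒≡1 (actᵀ (reverse w) (fund letter) a) (proj₁ β≡κα) (trans (sym (αa≡κ∙ a)) (fund-diag a))
      β≡α : β ≗ fund letter
      β≡α k = trans (proj₂ β≡κα k) (trans (cong (_* fund letter k) κ≡1) (ℤ.*-identityˡ (fund letter k)))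

    inversion-coroot-nonneg : ∀ pre a suf → IsReduced (pre ++ a ∷ suf) → Nonneg (actᵀ suf (fund a))
    inversion-coroot-nonneg pre a suf reduced k with + 0 ℤ.≤? actᵀ suf (fund a) k
    ... | yes ≥0 = ≥0
    ... | no  ≱0 = ⊥-elim (cancellation-not-reduced pre a before letter after simple
                             (subst (λ s → IsReduced (pre ++ a ∷ s)) split reduced))
      where open SimpleStep (becomes-simple [] a suf (fund-nonneg a) (k , ℤ.≰⇒> ≱0))

    inversion-coroot-flips : ∀ pre a suf → IsReduced (pre ++ a ∷ suf) →
                             ∃[ k ] actᵀ (reverse (pre ++ a ∷ suf)) (actᵀ suf (fund a)) k ℤ.< + 0
    inversion-coroot-flips pre a suf reduced with Fin.any? (λ k → + 0 ℤ.<? η k)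
      where η = actᵀ (reverse pre) (fund a)
    ... | yes (k , 0<ηk) =
      k , subst (ℤ._< + 0) (sym (reverse∙γ≡-η k)) (subst (ℤ._< + 0) (sym (ℤ.-1*i≡-i (η k))) (ℤ.neg-mono-< 0<ηk))
      where
      open ≡-Reasoning
      η = actᵀ (reverse pre) (fund a)
      γ = actᵀ suf (fund a)
      reverse∙γ≡-η : ∀ k → actᵀ (reverse (pre ++ a ∷ suf)) γ k ≡ - (+ 1) * η k
      reverse∙γ≡-η k = begin
        actᵀ (reverse (pre ++ a ∷ suf)) γ k                ≡⟨ cong (λ z → actᵀ z γ k) (reverse-split pre a suf) ⟩
        actᵀ (reverse suf ++ a ∷ reverse pre) γ k          ≡⟨ cong (λ f → f k) (actᵀ-++ (reverse suf) (a ∷ reverse pre) γ) ⟩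
        actᵀ (reverse pre) (s∨ a (actᵀ (reverse suf) γ)) k ≡⟨ actᵀ-cong (reverse pre) (s∨-cong a (actᵀ-reverseˡ suf (fund a))) k ⟩
        actᵀ (reverse pre) (s∨ a (fund a)) k               ≡⟨ actᵀ-cong (reverse pre) (s∨-fund-diag a) k ⟩
        actᵀ (reverse pre) (λ k → - (+ 1) * fund a k) k    ≡⟨ actᵀ-scale (reverse pre) (- (+ 1)) (fund a) k ⟩
        - (+ 1) * η k                                      ∎
    ... | no ∄0<η = ⊥-elim (1≢0 (begin
      + 1                                 ≡⟨ fund-diag a ⟨
      fund a a                            ≡⟨ actᵀ-reverseʳ pre (fund a) a ⟨
      actᵀ pre η a                        ≡⟨ actᵀ-cong pre η≡0 a ⟩
      actᵀ pre (λ _ → + 0) a              ≡⟨ actᵀ-zero pre a ⟩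
      + 0                                 ∎))
      where
      open ≡-Reasoning
      η = actᵀ (reverse pre) (fund a)
      η≥0 : Nonneg η
      η≥0 = inversion-coroot-nonneg (reverse suf) a (reverse pre)
              (subst IsReduced (reverse-split pre a suf) (isReduced-reverse (pre ++ a ∷ suf) reduced))
      η≡0 : η ≗ (λ _ → + 0)
      η≡0 k = ℤ.≤-antisym (ℤ.≮⇒≥ (λ 0<ηk → ∄0<η (k , 0<ηk))) (η≥0 k)
      1≢0 : + 1 ≢ + 0
      1≢0 ()

    -- The inversion coroot γ of v at a turns negative along u, so it is an inversion coroot of u
    -- as well, and ⟨Λ, γ⟩ is the minuscule value 1 at that letter of u.
    minuscule-letter : ∀ u pre a suf {Λ} → MinWord t u Λ → (∀ c → actᵀ u c ≗ actᵀ (pre ++ a ∷ suf) c) →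
                       IsReduced (pre ++ a ∷ suf) → act t suf Λ a ≡ + 1
    minuscule-letter u pre a suf {Λ} u-minuscule u~v v-reduced = begin
      act t suf Λ a                                ≡⟨ act-coordinate suf Λ a ⟩
      ⟪ Λ , γ ⟫                                    ≡⟨ ⟪⟫-cong Λ γ≡ ⟩
      ⟪ Λ , actᵀ (reverse before) (fund letter) ⟫  ≡⟨ act-coordinate (reverse before) Λ letter ⟨
      act t (reverse before) Λ letter
        ≡⟨ MinWord-at (reverse after) letter (reverse before) (subst (λ w → MinWord t w Λ) u-split u-minuscule) ⟩
      + 1                                          ∎
      where
      open ≡-Reasoning
      v = pre ++ a ∷ suf
      γ = actᵀ suf (fund a)
      flips-along-u : ∃[ k ] actᵀ (reverse u) γ k ℤ.< + 0
      flips-along-u with inversion-coroot-flips pre a suf v-reduced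
      ... | k , negative = k , subst (ℤ._< + 0) (sym (actᵀ-reverse-cong u v u~v γ k)) negative
      open SimpleStep (becomes-simple suf a (reverse u) (inversion-coroot-nonneg pre a suf v-reduced) flips-along-u)
      γ≡ : γ ≗ actᵀ (reverse before) (fund letter)
      γ≡ k = trans (sym (actᵀ-reverseˡ before γ k)) (actᵀ-cong (reverse before) simple k)
      u-split : u ≡ reverse after ++ letter ∷ reverse before
      u-split = trans (sym (List.reverse-involutive u)) (trans (cong reverse split) (reverse-split before letter after))

    minuscule-reduced-word : ∀ u v {Λ} → MinWord t u Λ → (∀ c → actᵀ u c ≗ actᵀ v c) → IsReduced v → MinWord t v Λ
    minuscule-reduced-word u v u-minuscule u~v v-reduced = MinWord-from-letters v λ where
      pre a suf refl → minuscule-letter u pre a suf u-minuscule u~v v-reduced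

-- Parities along a minuscule word

module _ (t : CartanType) {n : ℕ} where

  rootSum : Fin n → Word n → ℤ
  rootSum k []      = + 0
  rootSum k (b ∷ s) = pair t k b + rootSum k s

  minusOnes : Fin n → Word n → ℕ
  minusOnes k s = length (filter (λ b → pair t k b ℤ.≟ - (+ 1)) s)

  act-minuscule : ∀ s {Λ} → MinWord t s Λ → ∀ k → act t s Λ k ≡ Λ k - rootSum k s
  act-minuscule []      {Λ} _                  k = sym (ℤ.+-identityʳ (Λ k))
  act-minuscule (b ∷ s) {Λ} (step , minuscule) k rewrite step | act-minuscule s minuscule k =
    regroup (Λ k) (rootSum k s) (pair t k b)
    where regroup : ∀ L S P → L - S - + 1 * P ≡ L - (P + S)
          regroup = solve-∀

  rootSum-parity : ∀ k s → ∃[ M ] rootSum k s ≡ - (+ minusOnes k s) + (M + M)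
  rootSum-parity k []      = + 0 , refl
  rootSum-parity k (b ∷ s) with pair t k b ℤ.≟ - (+ 1) | rootSum-parity k s
  ... | yes p≡-1 | M , S≡ = M , trans (cong₂ _+_ p≡-1 S≡) (regroup (+ minusOnes k s) M)
    where regroup : ∀ C M → - (+ 1) + (- C + (M + M)) ≡ - (+ 1 + C) + (M + M)
          regroup = solve-∀
  ... | no  p≢-1 | M , S≡ with cartan-evenOrMinusOne t (toℕ k) (toℕ b)
  ...   | inj₁ p≡-1      = ⊥-elim (p≢-1 p≡-1)
  ...   | inj₂ (m , p≡2m) = m + M , trans (cong₂ _+_ p≡2m S≡) (regroup (+ minusOnes k s) m M)
    where regroup : ∀ C m M → m + m + (- C + (M + M)) ≡ - C + ((m + M) + (m + M))
          regroup = solve-∀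

m+m≡m*2 : ∀ m → m ℕ.+ m ≡ m ℕ.* 2
m+m≡m*2 m = trans (cong (m ℕ.+_) (sym (ℕ.+-identityʳ m))) (ℕ.*-comm 2 m)

even⇒%2≡0 : ∀ c M → + c ≡ M + M → c % 2 ≡ 0
even⇒%2≡0 c (+ m) c≡m+m = trans (cong (_% 2) (trans (ℤ.+-injective c≡m+m) (m+m≡m*2 m))) ([m+kn]%n≡m%n 0 m 2)

odd⇒%2≡1 : ∀ c M → + c ≡ + 1 + (M + M) → c % 2 ≡ 1
odd⇒%2≡1 c (+ m) c≡1+m+m = trans (cong (_% 2) (trans (ℤ.+-injective c≡1+m+m) (cong suc (m+m≡m*2 m)))) ([m+kn]%n≡m%n 1 m 2)

split-at-lookup : ∀ {A : Set} (xs : List A) q → xs ≡ take (toℕ q) xs ++ lookup xs q ∷ drop (suc (toℕ q)) xs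
split-at-lookup (x ∷ xs) zero    = refl
split-at-lookup (x ∷ xs) (suc q) = cong (x ∷_) (split-at-lookup xs q)

letter-parity : ∀ t {n} (i : Fin n) pre a suf → MinWord t (pre ++ a ∷ suf) (fund i) →
  (a ≡ i → minusOnes t a suf % 2 ≡ 0) × (a ≢ i → minusOnes t a suf % 2 ≡ 1)
letter-parity t i pre a suf minuscule = even , odd
  where
  open ≡-Reasoning
  c = minusOnes t a suf
  M = proj₁ (rootSum-parity t a suf)
  count≡ : + c ≡ + 1 - fund i a + (M + M)
  count≡ = begin
    + c                                                    ≡⟨ isolate (+ c) (fund i a) (M + M) ⟩
    (fund i a - (- (+ c) + (M + M))) - fund i a + (M + M)  ≡⟨ cong (λ e → e - fund i a + (M + M)) value ⟩
    + 1 - fund i a + (M + M)                               ∎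
    where
    isolate : ∀ C f D → C ≡ (f - (- C + D)) - f + D
    isolate = solve-∀
    value : fund i a - (- (+ c) + (M + M)) ≡ + 1
    value = begin
      fund i a - (- (+ c) + (M + M))    ≡⟨ cong (_-_ (fund i a)) (proj₂ (rootSum-parity t a suf)) ⟨
      fund i a - rootSum t a suf        ≡⟨ act-minuscule t suf (MinWord-suffix pre a suf minuscule) a ⟨
      act t suf (fund i) a              ≡⟨ MinWord-at pre a suf minuscule ⟩
      + 1                               ∎
  even : a ≡ i → c % 2 ≡ 0
  even refl = even⇒%2≡0 c M (trans count≡ (trans (cong (λ f → + 1 - f + (M + M)) (fund-diag a)) (ℤ.+-identityˡ (M + M))))
  odd : a ≢ i → c % 2 ≡ 1
  odd a≢i = odd⇒%2≡1 c M (trans count≡ (cong (λ f → + 1 - f + (M + M)) (fund-off (a≢i ∘ sym))))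

lemma6p5 : (t : CartanType) (n : ℕ) → ValidRank t n →
    (i : Fin n) → InK t i →
    (w : Word n) → StrongMinusculeWith t w i →
    (ws : Word n) → ReducedExpr t ws w →
    (q : Fin (length ws)) → suc (toℕ q) < length ws →
    (lookup ws q ≡ i → uCount t ws q % 2 ≡ 0) ×
    (lookup ws q ≢ i → uCount t ws q % 2 ≡ 1)
lemma6p5 t n valid i _ w ((u , (u≈w , _) , u-minuscule) , _) ws (ws≈w , ws-minimal) q _ =
  letter-parity t i (take (toℕ q) ws) (lookup ws q) (drop (suc (toℕ q)) ws)
    (subst (λ v → MinWord t v (fund i)) (split-at-lookup ws q) ws-minuscule)
  where
  open CorootAction t {n}
  open Reduced t {n}
  u~ws : ∀ c → actᵀ u c ≗ actᵀ ws c
  u~ws c k = trans (SameElt⇒actᵀ u w u≈w c k) (sym (SameElt⇒actᵀ ws w ws≈w c k))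
  ws-reduced : IsReduced ws
  ws-reduced y y~ws = ws-minimal y (λ μ k → trans (actᵀ⇒SameElt y ws y~ws μ k) (ws≈w μ k))
  ws-minuscule : MinWord t ws (fund i)
  ws-minuscule = minuscule-reduced-word (positiveDefinite t n valid) u ws u-minuscule u~ws ws-reduced
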